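{- Let $p$ be greater than $1$ and let $U$ be the uniform distribution over $G_{n,p}$, that is, $U = \sum_{w\in G_{n,p}}\frac{1}{p^nn!}w$. Then, \[ d_{TV}\left(\left(\frac{1}{pn}{\mathbf B}_1\right)^k, \,U\right) \leq 1-\frac{{k\brace n}n!}{n^k}. \]
   Context: $G_{n,p}=C_p\wr\mathfrak S_n$ is the colored permutation group (pairs $(s,\sigma)$, $s\in C_p^n$, $\sigma\in\mathfrak S_n$, product $(t,\tau)(s,\sigma)=(\sigma t+s,\tau\sigma)$, $\sigma t=(t_{\sigma(1)},\ldots,t_{\sigma(n)})$), whose elements are regarded as words $(s_1,\sigma(1))\cdots(s_n,\sigma(n))$ over $C_p\times[n]$. For words $u,v$, $u\sqcup\!\sqcup v$ is the shuffle product (formal sum of all interleavings). With $W_{1,n}=(0,2)\cdots(0,n)$, ${\mathbf B}_1=\sum_{j=0}^{p-1}(j,1)\sqcup\!\sqcup W_{1,n}$, so $\frac{1}{pn}{\mathbf B}_1$ is the top-to-random shuffle distribution on $G_{n,p}$ and powers are taken in ${\mathbb R}G_{n,p}$. $d_{TV}({\bf P},{\bf Q})=\frac12|{\bf P}-{\bf Q}|$, where $|\sum c_w w|=\sum|c_w|$. ${k\brace n}$ is the Stirling number of the second kind. -}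

module Defs where

open import Data.Nat as ℕ using (ℕ; zero; suc; NonZero; _!)
open import Data.Nat.Properties using (m*n≢0; m^n≢0; _!≢0)
open import Data.Nat.DivMod using (_mod_)
open import Data.Fin as F using (Fin; toℕ)
import Data.Fin.Properties as FP
open import Data.Product using (_×_; _,_; proj₁; proj₂)
import Data.Product.Properties as PP
open import Data.List as L using (List; []; _∷_; [_]; _++_; map; concatMap; filter; allFin; cartesianProduct; length; foldr)
import Data.List.Properties as LP
open import Data.Vec as V using (Vec; lookup; toList)
open import Data.List.Relation.Unary.Unique.Propositional using (Unique)
import Data.List.Relation.Unary.Unique.DecPropositional as UD
open import Data.Integer using (+_)
open import Data.Rational as Q using (ℚ; 0ℚ; 1ℚ; _/_)
open import Relation.Binary.PropositionalEquality using (_≡_)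
open import Relation.Nullary.Decidable using (Dec; yes; no; ¬?)

-- Colored permutation group G_{n,p} = C_p ≀ S_n, elements as words
-- (s_1,σ(1))⋯(s_n,σ(n)).  The letter value i ∈ [n] is encoded by the
-- index i-1 : Fin n (0-based); colors are Fin p = ℤ/pℤ.

Letter : ℕ → ℕ → Set
Letter p n = Fin p × Fin n

Word : ℕ → ℕ → Set
Word p n = Vec (Letter p n) n

_⊕_ : ∀ {p} .{{_ : NonZero p}} → Fin p → Fin p → Fin p
_⊕_ {p} a b = (toℕ a ℕ.+ toℕ b) mod p

c0 : ∀ p .{{_ : NonZero p}} → Fin p
c0 (suc p) = F.zero

_≟L_ : ∀ {p n} → (x y : Letter p n) → Dec (x ≡ y)
_≟L_ = PP.≡-dec FP._≟_ FP._≟_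

_≟W_ : ∀ {p n} → (x y : Word p n) → Dec (x ≡ y)
_≟W_ = Data.Vec.Properties.≡-dec _≟L_
  where import Data.Vec.Properties

_≟Ls_ : ∀ {p n} → (x y : List (Letter p n)) → Dec (x ≡ y)
_≟Ls_ = LP.≡-dec _≟L_

allVecs : ∀ {A : Set} → List A → (m : ℕ) → List (Vec A m)
allVecs xs zero    = [ V.[] ]
allVecs xs (suc m) = concatMap (λ x → map (x V.∷_) (allVecs xs m)) xs

IsColoredPerm : ∀ {p n} → Word p n → Set
IsColoredPerm w = Unique (map proj₂ (toList w))

isColoredPerm? : ∀ {p n} → (w : Word p n) → Dec (IsColoredPerm w)
isColoredPerm? w = UD.unique? FP._≟_ (map proj₂ (toList w))

G : ∀ p n → List (Word p n)
G p n = filter isColoredPerm? (allVecs (cartesianProduct (allFin p) (allFin n)) n)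

-- group product (t,τ)(s,σ) = (σt + s, τσ), on words:
-- (u v)_i = (t_{σ(i)} + s_i , τ(σ(i)))  where v_i = (s_i, σ(i)), u_j = (t_j, τ(j))
_·_ : ∀ {p n} .{{_ : NonZero p}} → Word p n → Word p n → Word p n
u · v = V.map (λ { (s , j) → (proj₁ (lookup u j) ⊕ s , proj₂ (lookup u j)) }) v

e : ∀ p n .{{_ : NonZero p}} → Word p n
e p n = V.tabulate (λ i → (c0 p , i))

-- The group algebra ℚ G_{n,p}: an element Σ c_w w is given by its
-- coefficient function w ↦ c_w (supported on G_{n,p}).

ℚG : ℕ → ℕ → Set
ℚG p n = Word p n → ℚ

Σℚ : ∀ {A : Set} → List A → (A → ℚ) → ℚ
Σℚ xs f = foldr (λ x acc → f x Q.+ acc) 0ℚ xs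

δ : ∀ {p n} → Word p n → Word p n → ℚ
δ u w with u ≟W w
... | yes _ = 1ℚ
... | no _  = 0ℚ

_⋆_ : ∀ {p n} .{{_ : NonZero p}} → ℚG p n → ℚG p n → ℚG p n
_⋆_ {p} {n} x y w = Σℚ (G p n) (λ u → Σℚ (G p n) (λ v → x u Q.* y v Q.* δ (u · v) w))

𝟙 : ∀ p n .{{_ : NonZero p}} → ℚG p n
𝟙 p n = δ (e p n)

_^⋆_ : ∀ {p n} .{{_ : NonZero p}} → ℚG p n → ℕ → ℚG p n
_^⋆_ {p} {n} x zero    = 𝟙 p n
_^⋆_ {p} {n} x (suc k) = x ⋆ (x ^⋆ k)

scale : ∀ {p n} → ℚ → ℚG p n → ℚG p n
scale c x w = c Q.* x w

∥_∥₁ : ∀ {p n} → ℚG p n → ℚ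
∥_∥₁ {p} {n} x = Σℚ (G p n) (λ w → Q.∣ x w ∣)

dTV : ∀ {p n} → ℚG p n → ℚG p n → ℚ
dTV P R = (+ 1 / 2) Q.* ∥ (λ w → P w Q.- R w) ∥₁

-- Shuffle product of words (as the formal sum = list of all interleavings)

shuffle : ∀ {A : Set} → List A → List A → List (List A)
shuffle []       ys       = [ ys ]
shuffle (x ∷ xs) []       = [ x ∷ xs ]
shuffle (x ∷ xs) (y ∷ ys) =
  map (x ∷_) (shuffle xs (y ∷ ys)) ++ map (y ∷_) (shuffle (x ∷ xs) ys)

coeff : ∀ {p n} → List (List (Letter p n)) → ℚG p n
coeff ws w = + length (filter (λ l → l ≟Ls toList w) ws) / 1

W₁ : ∀ p n .{{_ : NonZero p}} → List (Letter p n)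
W₁ p zero    = []
W₁ p (suc m) = map (λ i → (c0 p , F.suc i)) (allFin m)

B₁ : ∀ p n .{{_ : NonZero p}} → ℚG p n
B₁ p zero    = coeff []
B₁ p (suc m) = coeff (concatMap (λ j → shuffle [ (j , F.zero) ] (W₁ p (suc m))) (allFin p))

topToRandom : ∀ p n .{{_ : NonZero p}} .{{_ : NonZero n}} → ℚG p n
topToRandom p n = scale (_/_ (+ 1) (p ℕ.* n) {{m*n≢0 p n}}) (B₁ p n)

uniform : ∀ p n .{{_ : NonZero p}} → ℚG p n
uniform p n w with isColoredPerm? w
... | yes _ = _/_ (+ 1) (p ℕ.^ n ℕ.* n !) {{m*n≢0 (p ℕ.^ n) (n !) {{m^n≢0 p n}} {{n !≢0}}}}
... | no _  = 0ℚ

S₂ : ℕ → ℕ → ℕ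
S₂ zero    zero    = 1
S₂ zero    (suc n) = 0
S₂ (suc k) zero    = 0
S₂ (suc k) (suc n) = suc n ℕ.* S₂ k (suc n) ℕ.+ S₂ k n

{-# OPTIONS --safe #-}
-- If T^k ≥ a·U pointwise, where T is the top-to-random distribution and U the uniform one, then d_TV(T^k, U) ≤ 1 − a,
-- because T^k has total mass at most 1 and U has mass 1. The pointwise bound with a = S(k,n) n!/n^k is proved by
-- induction on k for the sets O_a of colored permutations in which the cards a+1, …, n appear in increasing order
-- with colour 0: T^k(w) ≥ Σ_{a : w ∈ O_a} S(k,a)/(p^a n^k). A word of O_a is reached from O_a by the a·p moves of T
-- that insert the top card at one of the first a positions, and a word of O_{a+1} is reached from O_a by at least
-- one other move; this is the Stirling recurrence S(k+1,a+1) = (a+1) S(k,a+1) + S(k,a). Every word lies in O_n,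
-- which gives T^k ≥ S(k,n)/(p^n n^k) = a·U.
module Submission where

open import Data.Nat using (ℕ; NonZero)

module Fractions where

  open import Data.Nat as ℕ using (ℕ; suc; NonZero)
  import Data.Nat.Properties as ℕP
  open import Data.Integer as ℤ using (+_)
  import Data.Integer.Properties as ℤP
  open import Data.Rational as ℚ using (ℚ; _/_; 0ℚ; 1ℚ; _≤_)
  import Data.Rational.Properties as ℚP
  open import Data.Rational.Unnormalised as ℚᵘ using (mkℚᵘ)
  import Data.Rational.Unnormalised.Properties as ℚᵘP
  open import Relation.Binary.PropositionalEquality

  private
    toℚᵘ-/ : ∀ a b .{{_ : NonZero b}} → ℚ.toℚᵘ (+ a / b) ℚᵘ.≃ mkℚᵘ (+ a) (ℕ.pred b)
    toℚᵘ-/ a (suc b) = ℚP.toℚᵘ-fromℚᵘ (mkℚᵘ (+ a) b)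

  /-cong-cross : ∀ a b c d .{{_ : NonZero b}} .{{_ : NonZero d}} →
                 a ℕ.* d ≡ c ℕ.* b → + a / b ≡ + c / d
  /-cong-cross a b@(suc _) c d@(suc _) eq = ℚP.toℚᵘ-injective
    (ℚᵘP.≃-trans (toℚᵘ-/ a b) (ℚᵘP.≃-trans (ℚᵘ.*≡* eqℤ) (ℚᵘP.≃-sym (toℚᵘ-/ c d))))
    where
    eqℤ : + a ℤ.* + d ≡ + c ℤ.* + b
    eqℤ = trans (sym (ℤP.pos-* a d)) (trans (cong +_ eq) (ℤP.pos-* c b))

  /-mono-cross : ∀ a b c d .{{_ : NonZero b}} .{{_ : NonZero d}} →
                 a ℕ.* d ℕ.≤ c ℕ.* b → + a / b ≤ + c / d
  /-mono-cross a b@(suc _) c d@(suc _) le = ℚP.toℚᵘ-cancel-≤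
    (ℚᵘP.≤-respˡ-≃ (ℚᵘP.≃-sym (toℚᵘ-/ a b))
      (ℚᵘP.≤-respʳ-≃ (ℚᵘP.≃-sym (toℚᵘ-/ c d)) (ℚᵘ.*≤* leℤ)))
    where
    leℤ : + a ℤ.* + d ℤ.≤ + c ℤ.* + b
    leℤ = subst₂ ℤ._≤_ (ℤP.pos-* a d) (ℤP.pos-* c b) (ℤ.+≤+ le)

  /-*-/ : ∀ a b c d .{{_ : NonZero b}} .{{_ : NonZero d}} →
          (+ a / b) ℚ.* (+ c / d) ≡ _/_ (+ (a ℕ.* c)) (b ℕ.* d) {{ℕP.m*n≢0 b d}}
  /-*-/ a b@(suc _) c d@(suc _) = ℚP.toℚᵘ-injective
    (ℚᵘP.≃-trans (ℚP.toℚᵘ-homo-* (+ a / b) (+ c / d))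
    (ℚᵘP.≃-trans (ℚᵘP.*-cong (toℚᵘ-/ a b) (toℚᵘ-/ c d))
    (ℚᵘP.≃-trans (ℚᵘ.*≡* (cong₂ ℤ._*_ (sym (ℤP.pos-* a c)) refl))
                 (ℚᵘP.≃-sym (toℚᵘ-/ (a ℕ.* c) (b ℕ.* d) {{ℕP.m*n≢0 b d}})))))

  /-+-/ : ∀ a b c d .{{_ : NonZero b}} .{{_ : NonZero d}} →
          (+ a / b) ℚ.+ (+ c / d) ≡ _/_ (+ (a ℕ.* d ℕ.+ c ℕ.* b)) (b ℕ.* d) {{ℕP.m*n≢0 b d}}
  /-+-/ a b@(suc _) c d@(suc _) = ℚP.toℚᵘ-injective
    (ℚᵘP.≃-trans (ℚP.toℚᵘ-homo-+ (+ a / b) (+ c / d))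
    (ℚᵘP.≃-trans (ℚᵘP.+-cong (toℚᵘ-/ a b) (toℚᵘ-/ c d))
    (ℚᵘP.≃-trans (ℚᵘ.*≡* (cong₂ ℤ._*_ numerator refl))
                 (ℚᵘP.≃-sym (toℚᵘ-/ (a ℕ.* d ℕ.+ c ℕ.* b) (b ℕ.* d) {{ℕP.m*n≢0 b d}})))))
    where
    numerator : + a ℤ.* + d ℤ.+ + c ℤ.* + b ≡ + (a ℕ.* d ℕ.+ c ℕ.* b)
    numerator = trans (cong₂ ℤ._+_ (sym (ℤP.pos-* a d)) (sym (ℤP.pos-* c b))) (sym (ℤP.pos-+ (a ℕ.* d) (c ℕ.* b)))

  fromℕ : ℕ → ℚ
  fromℕ a = + a / 1

  fromℕ-+ : ∀ a b → fromℕ (a ℕ.+ b) ≡ fromℕ a ℚ.+ fromℕ b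
  fromℕ-+ a b = sym (trans (/-+-/ a 1 b 1) (cong (λ t → + t / 1) (cong₂ ℕ._+_ (ℕP.*-identityʳ a) (ℕP.*-identityʳ b))))

  fromℕ-* : ∀ a b → fromℕ (a ℕ.* b) ≡ fromℕ a ℚ.* fromℕ b
  fromℕ-* a b = sym (/-*-/ a 1 b 1)

  fromℕ-mono-≤ : ∀ {a b} → a ℕ.≤ b → fromℕ a ≤ fromℕ b
  fromℕ-mono-≤ {a} {b} le = /-mono-cross a 1 b 1 (subst₂ ℕ._≤_ (sym (ℕP.*-identityʳ a)) (sym (ℕP.*-identityʳ b)) le)

  0≤fromℕ : ∀ a → 0ℚ ≤ fromℕ a
  0≤fromℕ a = fromℕ-mono-≤ {0} {a} ℕ.z≤n

  1/n*n≡1 : ∀ n .{{_ : NonZero n}} → (+ 1 / n) ℚ.* fromℕ n ≡ 1ℚ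
  1/n*n≡1 n = trans (/-*-/ 1 n n 1) (/-cong-cross (1 ℕ.* n) (n ℕ.* 1) 1 1 {{ℕP.m*n≢0 n 1}} (ℕP.*-assoc 1 n 1))

  0≤/ : ∀ a b .{{_ : NonZero b}} → 0ℚ ≤ + a / b
  0≤/ a b = /-mono-cross 0 1 a b ℕ.z≤n

  *-monoʳ-≤-0≤ : ∀ {a b} c → 0ℚ ≤ c → a ≤ b → c ℚ.* a ≤ c ℚ.* b
  *-monoʳ-≤-0≤ c 0≤c = ℚP.*-monoˡ-≤-nonNeg c {{ℚ.nonNegative 0≤c}}

  *-monoˡ-≤-0≤ : ∀ {a b} c → 0ℚ ≤ c → a ≤ b → a ℚ.* c ≤ b ℚ.* c
  *-monoˡ-≤-0≤ c 0≤c = ℚP.*-monoʳ-≤-nonNeg c {{ℚ.nonNegative 0≤c}}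

  0≤-* : ∀ {a b} → 0ℚ ≤ a → 0ℚ ≤ b → 0ℚ ≤ a ℚ.* b
  0≤-* {a} {b} 0≤a 0≤b = subst (_≤ a ℚ.* b) (ℚP.*-zeroʳ a) (*-monoʳ-≤-0≤ a 0≤a 0≤b)

module Sums where

  open import Data.Nat using (ℕ; zero; suc; _<_)
  open import Data.Rational using (ℚ; 0ℚ; 1ℚ; _+_; _*_; _≤_)
  import Data.Rational.Properties as ℚP
  open import Algebra.Bundles using (CommutativeMonoid)
  open import Algebra.Properties.CommutativeSemigroup (CommutativeMonoid.commutativeSemigroup ℚP.+-0-commutativeMonoid)
    using () renaming (interchange to +-interchange)
  open import Data.List using (List; []; _∷_; _++_; [_]; map; length; cartesianProduct; applyUpTo; upTo)
  import Data.List.Properties as LP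
  open import Data.List.Membership.Propositional using (_∈_)
  open import Data.List.Membership.Propositional.Properties using (∈-∃++; ∈-++⁻; ∈-++⁺ˡ; ∈-++⁺ʳ)
  open import Data.List.Relation.Unary.Any using (here; there)
  import Data.List.Relation.Unary.Any.Properties as AnyP
  import Data.List.Relation.Unary.All.Properties as AllP
  open import Data.List.Relation.Unary.Unique.Propositional using (Unique; _∷_)
  open import Data.Product using (_,_)
  open import Data.Sum using (inj₁; inj₂)
  open import Data.Empty using (⊥-elim)
  open import Function using (id; _∘_)
  open import Relation.Binary.PropositionalEquality hiding ([_])
  open import Defs using (Σℚ)
  open Fractions

  module _ {A : Set} where
    Σ-++ : ∀ (xs ys : List A) f → Σℚ (xs ++ ys) f ≡ Σℚ xs f + Σℚ ys f
    Σ-++ []       ys f = sym (ℚP.+-identityˡ _)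
    Σ-++ (x ∷ xs) ys f = trans (cong (f x +_) (Σ-++ xs ys f)) (sym (ℚP.+-assoc (f x) _ _))

    Σ-cong : ∀ (xs : List A) {f g} → (∀ x → x ∈ xs → f x ≡ g x) → Σℚ xs f ≡ Σℚ xs g
    Σ-cong []       h = refl
    Σ-cong (x ∷ xs) h = cong₂ _+_ (h x (here refl)) (Σ-cong xs (λ y m → h y (there m)))

    Σ-mono-≤ : ∀ (xs : List A) {f g} → (∀ x → x ∈ xs → f x ≤ g x) → Σℚ xs f ≤ Σℚ xs g
    Σ-mono-≤ []       h = ℚP.≤-refl
    Σ-mono-≤ (x ∷ xs) h = ℚP.+-mono-≤ (h x (here refl)) (Σ-mono-≤ xs (λ y m → h y (there m)))

    0≤Σ : ∀ (xs : List A) {f} → (∀ x → x ∈ xs → 0ℚ ≤ f x) → 0ℚ ≤ Σℚ xs f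
    0≤Σ []       h = ℚP.≤-refl
    0≤Σ (x ∷ xs) h = ℚP.+-mono-≤ (h x (here refl)) (0≤Σ xs (λ y m → h y (there m)))

    Σ-0 : ∀ (xs : List A) → Σℚ xs (λ _ → 0ℚ) ≡ 0ℚ
    Σ-0 []       = refl
    Σ-0 (x ∷ xs) = trans (ℚP.+-identityˡ _) (Σ-0 xs)

    Σ-+ : ∀ (xs : List A) f g → Σℚ xs (λ x → f x + g x) ≡ Σℚ xs f + Σℚ xs g
    Σ-+ []       f g = refl
    Σ-+ (x ∷ xs) f g = trans (cong (f x + g x +_) (Σ-+ xs f g)) (+-interchange (f x) (g x) _ _)

    Σ-*ˡ : ∀ (xs : List A) c f → Σℚ xs (λ x → c * f x) ≡ c * Σℚ xs f
    Σ-*ˡ []       c f = sym (ℚP.*-zeroʳ c)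
    Σ-*ˡ (x ∷ xs) c f = trans (cong (c * f x +_) (Σ-*ˡ xs c f)) (sym (ℚP.*-distribˡ-+ c (f x) _))

    Σ-const : ∀ (xs : List A) c → Σℚ xs (λ _ → c) ≡ fromℕ (length xs) * c
    Σ-const []       c = sym (ℚP.*-zeroˡ c)
    Σ-const (x ∷ xs) c = begin
      c + Σℚ xs (λ _ → c)                 ≡⟨ cong₂ _+_ (sym (ℚP.*-identityˡ c)) (Σ-const xs c) ⟩
      1ℚ * c + fromℕ (length xs) * c      ≡⟨ sym (ℚP.*-distribʳ-+ c 1ℚ (fromℕ (length xs))) ⟩
      (1ℚ + fromℕ (length xs)) * c        ≡⟨ cong (_* c) (sym (fromℕ-+ 1 (length xs))) ⟩
      fromℕ (length (x ∷ xs)) * c         ∎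
      where open ≡-Reasoning

    ∈⇒≤Σ : ∀ (xs : List A) {f} x → x ∈ xs → (∀ y → y ∈ xs → 0ℚ ≤ f y) → f x ≤ Σℚ xs f
    ∈⇒≤Σ (y ∷ xs) {f} x (here refl) h =
      subst (_≤ f x + Σℚ xs f) (ℚP.+-identityʳ (f x)) (ℚP.+-monoʳ-≤ (f x) (0≤Σ xs (λ z m → h z (there m))))
    ∈⇒≤Σ (y ∷ xs) {f} x (there x∈xs) h =
      subst (_≤ f y + Σℚ xs f) (ℚP.+-identityˡ (f x))
            (ℚP.+-mono-≤ (h y (here refl)) (∈⇒≤Σ xs x x∈xs (λ z m → h z (there m))))

    Σ-⊆-mono-≤ : ∀ (ys xs : List A) f → Unique ys → (∀ y → y ∈ ys → y ∈ xs) →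
                 (∀ x → x ∈ xs → 0ℚ ≤ f x) → Σℚ ys f ≤ Σℚ xs f
    Σ-⊆-mono-≤ []       xs f u       sub nn = 0≤Σ xs nn
    Σ-⊆-mono-≤ (y ∷ ys) xs f (y∉ ∷ u) sub nn with ∈-∃++ (sub y (here refl))
    ... | as , bs , refl =
      subst (f y + Σℚ ys f ≤_) (sym Σ-remove-y) (ℚP.+-monoʳ-≤ (f y) (Σ-⊆-mono-≤ ys (as ++ bs) f u sub′ nn′))
      where
      sub′ : ∀ z → z ∈ ys → z ∈ as ++ bs
      sub′ z m with ∈-++⁻ as (sub z (there m))
      ... | inj₁ m₁        = ∈-++⁺ˡ m₁
      ... | inj₂ (here refl) = ⊥-elim (AllP.All¬⇒¬Any y∉ m)
      ... | inj₂ (there m₂) = ∈-++⁺ʳ as m₂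
      nn′ : ∀ z → z ∈ as ++ bs → 0ℚ ≤ f z
      nn′ z m with ∈-++⁻ as m
      ... | inj₁ m₁ = nn z (∈-++⁺ˡ m₁)
      ... | inj₂ m₂ = nn z (∈-++⁺ʳ as (there m₂))
      Σ-remove-y : Σℚ (as ++ y ∷ bs) f ≡ f y + Σℚ (as ++ bs) f
      Σ-remove-y = begin
        Σℚ (as ++ y ∷ bs) f          ≡⟨ Σ-++ as (y ∷ bs) f ⟩
        Σℚ as f + (f y + Σℚ bs f)    ≡⟨ sym (ℚP.+-assoc (Σℚ as f) (f y) _) ⟩
        Σℚ as f + f y + Σℚ bs f      ≡⟨ cong (_+ Σℚ bs f) (ℚP.+-comm (Σℚ as f) (f y)) ⟩
        f y + Σℚ as f + Σℚ bs f      ≡⟨ ℚP.+-assoc (f y) (Σℚ as f) _ ⟩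
        f y + (Σℚ as f + Σℚ bs f)    ≡⟨ cong (f y +_) (sym (Σ-++ as bs f)) ⟩
        f y + Σℚ (as ++ bs) f        ∎
        where open ≡-Reasoning

  module _ {A B : Set} where
    Σ-map : ∀ (g : A → B) (xs : List A) f → Σℚ (map g xs) f ≡ Σℚ xs (f ∘ g)
    Σ-map g []       f = refl
    Σ-map g (x ∷ xs) f = cong (f (g x) +_) (Σ-map g xs f)

    Σ-swap : ∀ (xs : List A) (ys : List B) (f : A → B → ℚ) →
             Σℚ xs (λ x → Σℚ ys (f x)) ≡ Σℚ ys (λ y → Σℚ xs (λ x → f x y))
    Σ-swap []       ys f = sym (Σ-0 ys)
    Σ-swap (x ∷ xs) ys f =
      trans (cong (Σℚ ys (f x) +_) (Σ-swap xs ys f)) (sym (Σ-+ ys (f x) (λ y → Σℚ xs (λ x′ → f x′ y))))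

  module _ {A B : Set} where
    Σ-cartesianProduct : ∀ (as : List A) (bs : List B) f →
                         Σℚ (cartesianProduct as bs) f ≡ Σℚ as (λ a → Σℚ bs (λ b → f (a , b)))
    Σ-cartesianProduct []       bs f = refl
    Σ-cartesianProduct (a ∷ as) bs f =
      trans (Σ-++ (map (a ,_) bs) _ f) (cong₂ _+_ (Σ-map (a ,_) bs f) (Σ-cartesianProduct as bs f))

  applyUpTo-∘ : ∀ {A B : Set} (f : A → B) (g : ℕ → A) n → applyUpTo (f ∘ g) n ≡ map f (applyUpTo g n)
  applyUpTo-∘ f g zero    = refl
  applyUpTo-∘ f g (suc n) = cong (f (g 0) ∷_) (applyUpTo-∘ f (g ∘ suc) n)

  ∈-upTo⁻ : ∀ {a t} → a ∈ upTo t → a < t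
  ∈-upTo⁻ m with AnyP.applyUpTo⁻ id m
  ... | i , i<t , refl = i<t

  ∈-upTo⁺ : ∀ {a t} → a < t → a ∈ upTo t
  ∈-upTo⁺ = AnyP.applyUpTo⁺ id refl

  Σ-upTo-suc : ∀ t f → Σℚ (upTo (suc t)) f ≡ f 0 + Σℚ (upTo t) (f ∘ suc)
  Σ-upTo-suc t f = cong (f 0 +_) (trans (cong (λ xs → Σℚ xs f) (applyUpTo-∘ suc id t)) (Σ-map suc (upTo t) f))

  Σ-upTo-∷ʳ : ∀ t f → Σℚ (upTo (suc t)) f ≡ Σℚ (upTo t) f + f t
  Σ-upTo-∷ʳ t f = begin
    Σℚ (upTo (suc t)) f          ≡⟨ cong (λ xs → Σℚ xs f) (sym (LP.applyUpTo-∷ʳ id t)) ⟩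
    Σℚ (upTo t ++ [ t ]) f       ≡⟨ Σ-++ (upTo t) [ t ] f ⟩
    Σℚ (upTo t) f + (f t + 0ℚ)   ≡⟨ cong (Σℚ (upTo t) f +_) (ℚP.+-identityʳ (f t)) ⟩
    Σℚ (upTo t) f + f t          ∎
    where open ≡-Reasoning

module Counting where

  open import Data.Nat using (ℕ; zero; suc; _+_; _*_; _∸_; _≤_; _<?_; z≤n; s≤s)
  import Data.Nat.Properties as ℕP
  open import Data.Fin using (Fin; toℕ)
  open import Data.Bool using (Bool; true; false; if_then_else_; not; _∨_)
  open import Data.List as L using (List; []; _∷_; _++_; map; concatMap; length; filter; allFin)
  open import Data.Nat.ListAction using (sum)
  import Data.List.Properties as LP
  open import Data.List.Membership.Propositional using (_∈_)
  open import Data.List.Relation.Unary.Any using (here; there)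
  import Data.List.Relation.Unary.All.Properties as AllP
  open import Data.List.Relation.Unary.Unique.Propositional using (Unique; _∷_)
  open import Data.Rational as ℚ using (ℚ; 0ℚ; 1ℚ)
  import Data.Rational.Properties as ℚP
  open import Relation.Nullary using (Dec; yes; no; does; ¬_)
  open import Relation.Nullary.Decidable using (dec-true; dec-false)
  open import Relation.Unary using (Pred; Decidable)
  open import Relation.Binary.PropositionalEquality
  open import Data.Empty using (⊥-elim)
  open import Function using (_∘_)
  open import Algebra.Properties.CommutativeSemigroup ℕP.+-commutativeSemigroup using () renaming (interchange to +-interchange)
  open import Defs using (Σℚ)
  open Fractions
  open Sums

  Σℕ : ∀ {A : Set} → List A → (A → ℕ) → ℕ
  Σℕ xs f = sum (map f xs)

  module _ {A : Set} where
    count : (A → Bool) → List A → ℕ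
    count P []       = 0
    count P (x ∷ xs) = if P x then suc (count P xs) else count P xs

    count-∷-true : ∀ P {x} {xs : List A} → P x ≡ true → count P (x ∷ xs) ≡ suc (count P xs)
    count-∷-true P Px rewrite Px = refl

    count-∷-false : ∀ P {x} {xs : List A} → P x ≡ false → count P (x ∷ xs) ≡ count P xs
    count-∷-false P Px rewrite Px = refl

    count-++ : ∀ P (xs ys : List A) → count P (xs ++ ys) ≡ count P xs + count P ys
    count-++ P []       ys = refl
    count-++ P (x ∷ xs) ys with P x
    ... | true  = cong suc (count-++ P xs ys)
    ... | false = count-++ P xs ys

    count-cong : ∀ {P Q} (xs : List A) → (∀ x → x ∈ xs → P x ≡ Q x) → count P xs ≡ count Q xs
    count-cong []               h = refl
    count-cong {P} {Q} (x ∷ xs) h rewrite h x (here refl) with Q x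
    ... | true  = cong suc (count-cong xs (λ y m → h y (there m)))
    ... | false = count-cong xs (λ y m → h y (there m))

    length-filter≡count : ∀ {ℓ} {P : Pred A ℓ} (P? : Decidable P) xs →
                          length (filter P? xs) ≡ count (λ x → does (P? x)) xs
    length-filter≡count P? []       = refl
    length-filter≡count P? (x ∷ xs) with does (P? x)
    ... | true  = cong suc (length-filter≡count P? xs)
    ... | false = length-filter≡count P? xs

    count-false : ∀ (xs : List A) → count (λ _ → false) xs ≡ 0
    count-false []       = refl
    count-false (x ∷ xs) = count-false xs

    count-none : ∀ P (xs : List A) → (∀ x → x ∈ xs → P x ≡ false) → count P xs ≡ 0
    count-none P xs h = trans (count-cong xs h) (count-false xs)

    count-not+count : ∀ P (xs : List A) → count (not ∘ P) xs + count P xs ≡ length xs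
    count-not+count P []       = refl
    count-not+count P (x ∷ xs) with P x
    ... | true  = trans (ℕP.+-suc _ _) (cong suc (count-not+count P xs))
    ... | false = cong suc (count-not+count P xs)

    count-∨-disjoint : ∀ P Q (xs : List A) → (∀ x → x ∈ xs → P x ≡ true → Q x ≡ false) →
                       count (λ x → P x ∨ Q x) xs ≡ count P xs + count Q xs
    count-∨-disjoint P Q []       h = refl
    count-∨-disjoint P Q (x ∷ xs) h with P x in eqP | Q x in eqQ
    ... | true  | true  = ⊥-elim (true≢false (trans (sym eqQ) (h x (here refl) eqP)))
      where
      true≢false : true ≢ false
      true≢false ()
    ... | true  | false = cong suc (count-∨-disjoint P Q xs (λ y m → h y (there m)))
    ... | false | true  = trans (cong suc (count-∨-disjoint P Q xs (λ y m → h y (there m)))) (sym (ℕP.+-suc _ _))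
    ... | false | false = count-∨-disjoint P Q xs (λ y m → h y (there m))

    count≤1 : ∀ P (xs : List A) → Unique xs →
              (∀ x y → x ∈ xs → y ∈ xs → P x ≡ true → P y ≡ true → x ≡ y) → count P xs ≤ 1
    count≤1 P []       u        h = z≤n
    count≤1 P (x ∷ xs) (x∉ ∷ u) h with P x in eq
    ... | true  = s≤s (ℕP.≤-reflexive (count-none P xs others))
      where
      others : ∀ y → y ∈ xs → P y ≡ false
      others y m with P y in eq′
      ... | true  = ⊥-elim (AllP.All¬⇒¬Any x∉ (subst (_∈ xs) (h y x (there m) (here refl) eq′ eq) m))
      ... | false = refl
    ... | false = count≤1 P xs u (λ a b ma mb → h a b (there ma) (there mb))

    1≤count : ∀ P (xs : List A) {x} → x ∈ xs → P x ≡ true → 1 ≤ count P xs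
    1≤count P (y ∷ xs) (here refl) Px rewrite Px = s≤s z≤n
    1≤count P (y ∷ xs) (there m)   Px with P y
    ... | true  = s≤s z≤n
    ... | false = 1≤count P xs m Px

    count≡1 : ∀ P (xs : List A) y → Unique xs → y ∈ xs → P y ≡ true →
              (∀ x → x ∈ xs → P x ≡ true → x ≡ y) → count P xs ≡ 1
    count≡1 P xs y u y∈xs Py h = ℕP.≤-antisym
      (count≤1 P xs u (λ a b ma mb Pa Pb → trans (h a ma Pa) (sym (h b mb Pb))))
      (1≤count P xs y∈xs Py)

    count≡Σℕ : ∀ P (xs : List A) → count P xs ≡ Σℕ xs (λ x → if P x then 1 else 0)
    count≡Σℕ P []       = refl
    count≡Σℕ P (x ∷ xs) with P x
    ... | true  = cong suc (count≡Σℕ P xs)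
    ... | false = count≡Σℕ P xs

    Σℕ-cong : ∀ (xs : List A) {f g} → (∀ x → x ∈ xs → f x ≡ g x) → Σℕ xs f ≡ Σℕ xs g
    Σℕ-cong []       h = refl
    Σℕ-cong (x ∷ xs) h = cong₂ _+_ (h x (here refl)) (Σℕ-cong xs (λ y m → h y (there m)))

    Σℕ-if : ∀ (xs : List A) P c → Σℕ xs (λ x → if P x then c else 0) ≡ count P xs * c
    Σℕ-if []       P c = refl
    Σℕ-if (x ∷ xs) P c with P x
    ... | true  = cong (c +_) (Σℕ-if xs P c)
    ... | false = Σℕ-if xs P c

    Σℕ-const : ∀ (xs : List A) c → Σℕ xs (λ _ → c) ≡ length xs * c
    Σℕ-const []       c = refl
    Σℕ-const (x ∷ xs) c = cong (c +_) (Σℕ-const xs c)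

    Σℕ-mono-≤ : ∀ (xs : List A) {f g} → (∀ x → x ∈ xs → f x ≤ g x) → Σℕ xs f ≤ Σℕ xs g
    Σℕ-mono-≤ []       h = z≤n
    Σℕ-mono-≤ (x ∷ xs) h = ℕP.+-mono-≤ (h x (here refl)) (Σℕ-mono-≤ xs (λ y m → h y (there m)))

    Σℕ-0 : ∀ (xs : List A) → Σℕ xs (λ _ → 0) ≡ 0
    Σℕ-0 []       = refl
    Σℕ-0 (x ∷ xs) = Σℕ-0 xs

    Σℕ-+ : ∀ (xs : List A) f g → Σℕ xs (λ x → f x + g x) ≡ Σℕ xs f + Σℕ xs g
    Σℕ-+ []       f g = refl
    Σℕ-+ (x ∷ xs) f g = trans (cong (f x + g x +_) (Σℕ-+ xs f g)) (+-interchange (f x) (g x) _ _)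

    Σ-if : ∀ (xs : List A) P c → Σℚ xs (λ x → if P x then c else 0ℚ) ≡ fromℕ (count P xs) ℚ.* c
    Σ-if []       P c = sym (ℚP.*-zeroˡ c)
    Σ-if (x ∷ xs) P c with P x
    ... | true  = begin
      c ℚ.+ Σℚ xs (λ x → if P x then c else 0ℚ)      ≡⟨ cong₂ ℚ._+_ (sym (ℚP.*-identityˡ c)) (Σ-if xs P c) ⟩
      1ℚ ℚ.* c ℚ.+ fromℕ (count P xs) ℚ.* c          ≡⟨ sym (ℚP.*-distribʳ-+ c 1ℚ (fromℕ (count P xs))) ⟩
      (1ℚ ℚ.+ fromℕ (count P xs)) ℚ.* c              ≡⟨ cong (ℚ._* c) (sym (fromℕ-+ 1 (count P xs))) ⟩
      fromℕ (suc (count P xs)) ℚ.* c                 ∎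
      where open ≡-Reasoning
    ... | false = trans (ℚP.+-identityˡ _) (Σ-if xs P c)

  module _ {A B : Set} where
    count-map : ∀ P (f : A → B) xs → count P (map f xs) ≡ count (λ x → P (f x)) xs
    count-map P f []       = refl
    count-map P f (x ∷ xs) with P (f x)
    ... | true  = cong suc (count-map P f xs)
    ... | false = count-map P f xs

    count-concatMap : ∀ P (f : A → List B) xs → count P (concatMap f xs) ≡ Σℕ xs (λ x → count P (f x))
    count-concatMap P f []       = refl
    count-concatMap P f (x ∷ xs) = trans (count-++ P (f x) (concatMap f xs)) (cong (count P (f x) +_) (count-concatMap P f xs))

    Σℕ-swap : ∀ (xs : List A) (ys : List B) (f : A → B → ℕ) →
              Σℕ xs (λ x → Σℕ ys (f x)) ≡ Σℕ ys (λ y → Σℕ xs (λ x → f x y))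
    Σℕ-swap []       ys f = sym (Σℕ-0 ys)
    Σℕ-swap (x ∷ xs) ys f =
      trans (cong (Σℕ ys (f x) +_) (Σℕ-swap xs ys f)) (sym (Σℕ-+ ys (f x) (λ y → Σℕ xs (λ x′ → f x′ y))))

  consecutive : ℕ → ℕ → List ℕ
  consecutive b zero    = []
  consecutive b (suc t) = b ∷ consecutive (suc b) t

  private
    tabulate-consecutive : ∀ b t → L.tabulate {n = t} (λ i → b + toℕ i) ≡ consecutive b t
    tabulate-consecutive b zero    = refl
    tabulate-consecutive b (suc t) = cong₂ _∷_ (ℕP.+-identityʳ b)
      (trans (LP.tabulate-cong (λ i → ℕP.+-suc b (toℕ i))) (tabulate-consecutive (suc b) t))

    count-<-consecutive : ∀ a b t → a ≤ b + t → count (λ s → does (s <? a)) (consecutive b t) ≡ a ∸ b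
    count-<-consecutive a b zero    le = sym (ℕP.m≤n⇒m∸n≡0 (subst (a ≤_) (ℕP.+-identityʳ b) le))
    count-<-consecutive a b (suc t) le with b <? a
    ... | yes b<a = trans (count-∷-true (λ s → does (s <? a)) {xs = consecutive (suc b) t} (dec-true (b <? a) b<a))
                    (trans (cong suc (count-<-consecutive a (suc b) t (subst (a ≤_) (ℕP.+-suc b t) le)))
                          (sym (ℕP.+-∸-assoc 1 b<a)))
    ... | no  b≮a = trans (count-∷-false (λ s → does (s <? a)) {xs = consecutive (suc b) t} (dec-false (b <? a) b≮a))
                    (trans (count-<-consecutive a (suc b) t (subst (a ≤_) (ℕP.+-suc b t) le))
                          (trans (ℕP.m≤n⇒m∸n≡0 (ℕP.≤-trans (ℕP.≮⇒≥ b≮a) (ℕP.n≤1+n b)))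
                                 (sym (ℕP.m≤n⇒m∸n≡0 (ℕP.≮⇒≥ b≮a)))))

  count-<-allFin : ∀ n a → a ≤ n → count (λ (i : Fin n) → does (toℕ i <? a)) (allFin n) ≡ a
  count-<-allFin n a le = begin
    count (λ i → does (toℕ i <? a)) (allFin n)   ≡⟨ sym (count-map (λ s → does (s <? a)) toℕ (allFin n)) ⟩
    count (λ s → does (s <? a)) (map toℕ (allFin n))
      ≡⟨ cong (count (λ s → does (s <? a))) (trans (LP.map-tabulate (λ i → i) toℕ) (tabulate-consecutive 0 n)) ⟩
    count (λ s → does (s <? a)) (consecutive 0 n) ≡⟨ count-<-consecutive a 0 n le ⟩
    a                                             ∎
    where open ≡-Reasoning

  length-concatMap : ∀ {A B : Set} (f : A → List B) xs → length (concatMap f xs) ≡ Σℕ xs (length ∘ f)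
  length-concatMap f []       = refl
  length-concatMap f (x ∷ xs) = trans (LP.length-++ (f x)) (cong (length (f x) +_) (length-concatMap f xs))

  Σ-fromℕ : ∀ {A : Set} (xs : List A) f → Σℚ xs (fromℕ ∘ f) ≡ fromℕ (Σℕ xs f)
  Σ-fromℕ []       f = refl
  Σ-fromℕ (x ∷ xs) f = trans (cong (fromℕ (f x) ℚ.+_) (Σ-fromℕ xs f)) (sym (fromℕ-+ (f x) _))

  module _ {ℓ} {X : Set ℓ} where
    when : Dec X → ℚ → ℚ
    when d q = if does d then q else 0ℚ

    unless : Dec X → ℚ → ℚ
    unless d q = if does d then 0ℚ else q

    when-yes : ∀ (d : Dec X) {q} → X → when d q ≡ q
    when-yes (yes _) x = refl
    when-yes (no ¬x) x = ⊥-elim (¬x x)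

    unless-no : ∀ (d : Dec X) {q} → ¬ X → unless d q ≡ q
    unless-no (yes x) ¬x = ⊥-elim (¬x x)
    unless-no (no _)  ¬x = refl

    when+unless : ∀ (d : Dec X) q → when d q ℚ.+ unless d q ≡ q
    when+unless (yes _) q = ℚP.+-identityʳ q
    when+unless (no _)  q = ℚP.+-identityˡ q

    when-cong : ∀ (d : Dec X) {q r} → (X → q ≡ r) → when d q ≡ when d r
    when-cong (yes x) eq = eq x
    when-cong (no _)  eq = refl

    when-≡0 : ∀ (d : Dec X) {q} → (X → q ≡ 0ℚ) → when d q ≡ 0ℚ
    when-≡0 (yes x) q≡0 = q≡0 x
    when-≡0 (no _)  q≡0 = refl

    0≤when : ∀ (d : Dec X) {q} → 0ℚ ℚ.≤ q → 0ℚ ℚ.≤ when d q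
    0≤when (yes _) 0≤q = 0≤q
    0≤when (no _)  0≤q = ℚP.≤-refl

    0≤unless : ∀ (d : Dec X) {q} → 0ℚ ℚ.≤ q → 0ℚ ℚ.≤ unless d q
    0≤unless (yes _) 0≤q = ℚP.≤-refl
    0≤unless (no _)  0≤q = 0≤q

    when-≤ : ∀ (d : Dec X) {q r} → 0ℚ ℚ.≤ r → (X → q ℚ.≤ r) → when d q ℚ.≤ r
    when-≤ (yes x) 0≤r q≤r = q≤r x
    when-≤ (no _)  0≤r q≤r = 0≤r

    Σ-when : ∀ {A : Set} (xs : List A) (d : Dec X) f → Σℚ xs (λ x → when d (f x)) ≡ when d (Σℚ xs f)
    Σ-when xs (yes _) f = refl
    Σ-when xs (no _)  f = Σ-0 xs

module Enumeration where

  open import Data.Nat using (ℕ; zero; suc; NonZero)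
  open import Data.Product using (_×_; _,_; proj₁; proj₂)
  open import Data.List using (List; []; _∷_; map; concatMap; allFin; cartesianProduct)
  open import Data.List.Membership.Propositional using (_∈_; find)
  open import Data.List.Membership.Propositional.Properties
    using (∈-concatMap⁺; ∈-concatMap⁻; ∈-map⁺; ∈-map⁻; ∈-filter⁺; ∈-filter⁻; ∈-cartesianProduct⁺; ∈-allFin)
  open import Data.List.Relation.Unary.Any as Any using (here)
  open import Data.List.Relation.Unary.All using ([])
  import Data.List.Relation.Unary.All.Properties as AllP
  open import Data.List.Relation.Unary.Unique.Propositional using (Unique; []; _∷_)
  import Data.List.Relation.Unary.Unique.Propositional.Properties as UniqueP
  open import Data.Vec as V using (Vec)
  import Data.Vec.Properties as VecP
  open import Data.Rational using (0ℚ; 1ℚ; _+_; _≤_)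
  import Data.Rational.Properties as ℚP
  open import Relation.Nullary using (yes; no; ¬_)
  open import Relation.Binary.PropositionalEquality
  open import Data.Empty using (⊥-elim)
  open import Defs
  open Sums

  module _ {A : Set} where
    Unique-concatMap⁺ : ∀ {B : Set} (f : A → List B) (xs : List A) → Unique xs → (∀ x → Unique (f x)) →
                        (∀ x y z → z ∈ f x → z ∈ f y → x ≡ y) → Unique (concatMap f xs)
    Unique-concatMap⁺ f []       u        uf disjoint = []
    Unique-concatMap⁺ f (x ∷ xs) (x∉ ∷ u) uf disjoint =
      UniqueP.++⁺ (uf x) (Unique-concatMap⁺ f xs u uf disjoint) not-both
      where
      not-both : ∀ {z} → ¬ (z ∈ f x × z ∈ concatMap f xs)
      not-both (z∈fx , z∈rest) with find (∈-concatMap⁻ f {xs = xs} z∈rest)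
      ... | y , y∈xs , z∈fy = AllP.All¬⇒¬Any x∉ (subst (_∈ xs) (sym (disjoint x y _ z∈fx z∈fy)) y∈xs)

    ∈-allVecs : ∀ (xs : List A) k (v : Vec A k) → (∀ x → x ∈ xs) → v ∈ allVecs xs k
    ∈-allVecs xs zero    V.[]       all = here refl
    ∈-allVecs xs (suc k) (x V.∷ v) all =
      ∈-concatMap⁺ (λ x′ → map (x′ V.∷_) (allVecs xs k))
                   (Any.map (λ { refl → ∈-map⁺ (x V.∷_) (∈-allVecs xs k v all) }) (all x))

    Unique-allVecs : ∀ (xs : List A) k → Unique xs → Unique (allVecs xs k)
    Unique-allVecs xs zero    u = [] ∷ []
    Unique-allVecs xs (suc k) u = Unique-concatMap⁺ _ xs u
      (λ x → UniqueP.map⁺ (λ eq → proj₂ (VecP.∷-injective eq)) (Unique-allVecs xs k u))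
      same-head
      where
      same-head : ∀ x y z → z ∈ map (x V.∷_) (allVecs xs k) → z ∈ map (y V.∷_) (allVecs xs k) → x ≡ y
      same-head x y z m₁ m₂ with ∈-map⁻ (x V.∷_) m₁ | ∈-map⁻ (y V.∷_) m₂
      ... | _ , _ , refl | _ , _ , eq = proj₁ (VecP.∷-injective eq)

  module _ (p n : ℕ) .{{_ : NonZero p}} where
    letters : List (Letter p n)
    letters = cartesianProduct (allFin p) (allFin n)

    ∈-letters : ∀ x → x ∈ letters
    ∈-letters (a , b) = ∈-cartesianProduct⁺ (∈-allFin a) (∈-allFin b)

    ∈-G⁺ : ∀ w → IsColoredPerm w → w ∈ G p n
    ∈-G⁺ w perm = ∈-filter⁺ isColoredPerm? (∈-allVecs letters n w ∈-letters) perm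

    ∈-G⁻ : ∀ {w} → w ∈ G p n → IsColoredPerm w
    ∈-G⁻ m = proj₂ (∈-filter⁻ isColoredPerm? {xs = allVecs letters n} m)

    Unique-G : Unique (G p n)
    Unique-G = UniqueP.filter⁺ isColoredPerm?
      (Unique-allVecs letters n (UniqueP.cartesianProduct⁺ (UniqueP.allFin⁺ p) (UniqueP.allFin⁺ n)))

  module _ {p n : ℕ} where
    δ-refl : ∀ (w : Word p n) → δ w w ≡ 1ℚ
    δ-refl w with w ≟W w
    ... | yes _ = refl
    ... | no w≢w = ⊥-elim (w≢w refl)

    δ-≢ : ∀ (u w : Word p n) → u ≢ w → δ u w ≡ 0ℚ
    δ-≢ u w u≢w with u ≟W w
    ... | yes u≡w = ⊥-elim (u≢w u≡w)
    ... | no _    = refl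

    0≤δ : ∀ (u w : Word p n) → 0ℚ ≤ δ u w
    0≤δ u w with u ≟W w
    ... | yes _ = ℚP.nonNegative⁻¹ 1ℚ
    ... | no _  = ℚP.≤-refl

    Σδ≤1 : ∀ z (xs : List (Word p n)) → Unique xs → Σℚ xs (δ z) ≤ 1ℚ
    Σδ≤1 z []       u        = ℚP.nonNegative⁻¹ 1ℚ
    Σδ≤1 z (x ∷ xs) (x∉ ∷ u) with z ≟W x
    ... | yes refl = ℚP.≤-reflexive (trans (cong (1ℚ +_) Σ-rest≡0) (ℚP.+-identityʳ 1ℚ))
      where
      Σ-rest≡0 : Σℚ xs (δ z) ≡ 0ℚ
      Σ-rest≡0 = trans (Σ-cong xs (λ w w∈xs → δ-≢ z w (λ { refl → AllP.All¬⇒¬Any x∉ w∈xs }))) (Σ-0 xs)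
    ... | no _ = subst (_≤ 1ℚ) (sym (ℚP.+-identityˡ _)) (Σδ≤1 z xs u)

module GroupOrder where

  open import Data.Nat as ℕ using (ℕ; zero; suc; NonZero; _+_; _*_; _∸_; _^_; _!)
  import Data.Nat.Properties as ℕP
  open import Data.Nat.Solver using (module +-*-Solver)
  open import Data.Fin using (Fin)
  import Data.Fin.Properties as FinP
  open import Data.Bool using (Bool; true; false; if_then_else_; not; _∨_)
  open import Data.Product using (_×_; _,_; proj₁; proj₂)
  open import Data.List using (List; []; _∷_; map; allFin; cartesianProduct; length)
  import Data.List.Properties as LP
  open import Data.List.Membership.Propositional using (_∈_; _∉_)
  open import Data.List.Membership.Propositional.Properties using (∈-allFin)
  open import Data.List.Relation.Unary.Any using (here; there)
  open import Data.List.Relation.Unary.All as All using (All; []; _∷_)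
  import Data.List.Relation.Unary.All.Properties as AllP
  open import Data.List.Relation.Unary.Unique.Propositional using (Unique; []; _∷_)
  import Data.List.Relation.Unary.Unique.Propositional.Properties as UniqueP
  open import Data.Vec as V using (Vec; toList)
  open import Relation.Nullary using (yes; no; does; ¬_)
  open import Relation.Nullary.Decidable using (dec-true)
  open import Relation.Binary.PropositionalEquality
  open import Data.Empty using (⊥-elim)
  open import Defs
  open Counting
  open Enumeration

  module _ {n : ℕ} where
    _∈ᵇ_ : Fin n → List (Fin n) → Bool
    ℓ ∈ᵇ []      = false
    ℓ ∈ᵇ (y ∷ F) = does (ℓ FinP.≟ y) ∨ ℓ ∈ᵇ F

    ∈ᵇ⇒∈ : ∀ ℓ F → ℓ ∈ᵇ F ≡ true → ℓ ∈ F
    ∈ᵇ⇒∈ ℓ (y ∷ F) e with ℓ FinP.≟ y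
    ... | yes refl = here refl
    ... | no _     = there (∈ᵇ⇒∈ ℓ F e)

    ∈ᵇ-false⇒∉ : ∀ ℓ F → ℓ ∈ᵇ F ≡ false → ℓ ∉ F
    ∈ᵇ-false⇒∉ ℓ (y ∷ F) e       m         with ℓ FinP.≟ y
    ∈ᵇ-false⇒∉ ℓ (y ∷ F) ()      m         | yes _
    ∈ᵇ-false⇒∉ ℓ (y ∷ F) e       (here eq) | no ℓ≢y = ℓ≢y eq
    ∈ᵇ-false⇒∉ ℓ (y ∷ F) e       (there m) | no _   = ∈ᵇ-false⇒∉ ℓ F e m

    ∉⇒∈ᵇ-false : ∀ ℓ F → ℓ ∉ F → ℓ ∈ᵇ F ≡ false
    ∉⇒∈ᵇ-false ℓ F ℓ∉F with ℓ ∈ᵇ F in eq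
    ... | true  = ⊥-elim (ℓ∉F (∈ᵇ⇒∈ ℓ F eq))
    ... | false = refl

    count-∈ᵇ-allFin : ∀ F → Unique F → count (_∈ᵇ F) (allFin n) ≡ length F
    count-∈ᵇ-allFin []      u        = count-false (allFin n)
    count-∈ᵇ-allFin (y ∷ F) (y∉ ∷ u) =
      trans (count-∨-disjoint (λ ℓ → does (ℓ FinP.≟ y)) (_∈ᵇ F) (allFin n) disjoint)
            (cong₂ _+_ (count≡1 _ (allFin n) y (UniqueP.allFin⁺ n) (∈-allFin y) (dec-true (y FinP.≟ y) refl)
                                (λ x _ e → ≟-sound x e))
                       (count-∈ᵇ-allFin F u))
      where
      ≟-sound : ∀ x → does (x FinP.≟ y) ≡ true → x ≡ y
      ≟-sound x e with x FinP.≟ y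
      ... | yes x≡y = x≡y
      disjoint : ∀ x → x ∈ allFin n → does (x FinP.≟ y) ≡ true → x ∈ᵇ F ≡ false
      disjoint x _ e rewrite ≟-sound x e = ∉⇒∈ᵇ-false y F (AllP.All¬⇒¬Any y∉)

    count-∉ᵇ-allFin : ∀ F → Unique F → count (λ ℓ → not (ℓ ∈ᵇ F)) (allFin n) ≡ n ∸ length F
    count-∉ᵇ-allFin F u = begin
      count (λ ℓ → not (ℓ ∈ᵇ F)) (allFin n)
        ≡⟨ sym (ℕP.m+n∸n≡m _ (count (_∈ᵇ F) (allFin n))) ⟩
      count (λ ℓ → not (ℓ ∈ᵇ F)) (allFin n) + count (_∈ᵇ F) (allFin n) ∸ count (_∈ᵇ F) (allFin n)
        ≡⟨ cong₂ _∸_ (trans (count-not+count (_∈ᵇ F) (allFin n)) (LP.length-tabulate {n = n} (λ i → i)))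
                     (count-∈ᵇ-allFin F u) ⟩
      n ∸ length F
        ∎
      where open ≡-Reasoning

    Unique⇒∈ : ∀ F → Unique F → length F ≡ n → ∀ ℓ → ℓ ∈ F
    Unique⇒∈ F u len ℓ with ℓ ∈ᵇ F in eq
    ... | true  = ∈ᵇ⇒∈ ℓ F eq
    ... | false = ⊥-elim (1≰0 (subst (1 ℕ.≤_) none-missing (1≤count _ (allFin n) (∈-allFin ℓ) (cong not eq))))
      where
      1≰0 : ¬ (1 ℕ.≤ 0)
      1≰0 ()
      none-missing : count (λ ℓ′ → not (ℓ′ ∈ᵇ F)) (allFin n) ≡ 0
      none-missing = trans (count-∉ᵇ-allFin F u) (trans (cong (n ∸_) len) (ℕP.n∸n≡0 n))

    -- A duplicate-free check that threads the already used labels F, so that it computes letter by letter.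
    fresh : List (Fin n) → List (Fin n) → Bool
    fresh F []       = true
    fresh F (ℓ ∷ ls) = if ℓ ∈ᵇ F then false else fresh (ℓ ∷ F) ls

    fresh-sound : ∀ F ls → fresh F ls ≡ true → Unique ls × All (_∉ F) ls
    fresh-sound F []       e = [] , []
    fresh-sound F (ℓ ∷ ls) e with ℓ ∈ᵇ F in eq
    ... | false with fresh-sound (ℓ ∷ F) ls e
    ... | u , avoid = All.map (λ ∉ℓF eq′ → ∉ℓF (here (sym eq′))) avoid ∷ u
                    , ∈ᵇ-false⇒∉ ℓ F eq ∷ All.map (λ ∉ℓF m → ∉ℓF (there m)) avoid

    fresh-complete : ∀ F ls → Unique ls → All (_∉ F) ls → fresh F ls ≡ true
    fresh-complete F []       u          avoid         = refl
    fresh-complete F (ℓ ∷ ls) (ℓ∉ls ∷ u) (ℓ∉F ∷ avoid) rewrite ∉⇒∈ᵇ-false ℓ F ℓ∉F =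
      fresh-complete (ℓ ∷ F) ls u
        (All.zipWith (λ { (ℓ≢ , ∉F) → λ { (here eq) → ℓ≢ (sym eq) ; (there m) → ∉F m } }) (ℓ∉ls , avoid))

  fallingFactorial : ℕ → ℕ → ℕ
  fallingFactorial a zero    = 1
  fallingFactorial a (suc k) = a * fallingFactorial (ℕ.pred a) k

  fallingFactorial-! : ∀ n → fallingFactorial n n ≡ n !
  fallingFactorial-! zero    = refl
  fallingFactorial-! (suc n) = cong (suc n *_) (fallingFactorial-! n)

  module _ (p n : ℕ) .{{_ : NonZero p}} where
    labels : ∀ {k} → Vec (Letter p n) k → List (Fin n)
    labels v = map proj₂ (toList v)

    count-∉ᵇ-letters : ∀ (F : List (Fin n)) → Unique F →
                       count (λ x → not (proj₂ x ∈ᵇ F)) (letters p n) ≡ p * (n ∸ length F)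
    count-∉ᵇ-letters F u = trans (go (allFin p)) (cong (_* (n ∸ length F)) (LP.length-tabulate {n = p} (λ i → i)))
      where
      go : ∀ (cs : List (Fin p)) →
           count (λ x → not (proj₂ x ∈ᵇ F)) (cartesianProduct cs (allFin n)) ≡ length cs * (n ∸ length F)
      go []       = refl
      go (c ∷ cs) = trans (count-++ _ (map (c ,_) (allFin n)) _)
        (cong₂ _+_ (trans (count-map _ (c ,_) (allFin n)) (count-∉ᵇ-allFin F u)) (go cs))

    count-fresh-allVecs : ∀ k (F : List (Fin n)) → Unique F →
      count (λ v → fresh F (labels v)) (allVecs (letters p n) k) ≡ p ^ k * fallingFactorial (n ∸ length F) k
    count-fresh-allVecs zero    F u = refl
    count-fresh-allVecs (suc k) F u = begin
      count (λ v → fresh F (labels v)) (allVecs (letters p n) (suc k))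
        ≡⟨ count-concatMap _ (λ x → map (x V.∷_) (allVecs (letters p n) k)) (letters p n) ⟩
      Σℕ (letters p n) (λ x → count (λ v → fresh F (labels v)) (map (x V.∷_) (allVecs (letters p n) k)))
        ≡⟨ Σℕ-cong (letters p n) (λ x _ → trans (count-map _ (x V.∷_) (allVecs (letters p n) k)) (extend x)) ⟩
      Σℕ (letters p n) (λ x → if not (proj₂ x ∈ᵇ F) then c else 0)
        ≡⟨ Σℕ-if (letters p n) _ c ⟩
      count (λ x → not (proj₂ x ∈ᵇ F)) (letters p n) * c
        ≡⟨ cong (_* c) (count-∉ᵇ-letters F u) ⟩
      p * (n ∸ length F) * c
        ≡⟨ regroup ⟩
      p ^ suc k * fallingFactorial (n ∸ length F) (suc k)
        ∎
      where
      open ≡-Reasoning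
      c = p ^ k * fallingFactorial (n ∸ suc (length F)) k
      extend : ∀ x → count (λ v → fresh F (labels (x V.∷ v))) (allVecs (letters p n) k)
                   ≡ (if not (proj₂ x ∈ᵇ F) then c else 0)
      extend x with proj₂ x ∈ᵇ F in eq
      ... | true  = count-false (allVecs (letters p n) k)
      ... | false = count-fresh-allVecs k (proj₂ x ∷ F) (AllP.¬Any⇒All¬ F (∈ᵇ-false⇒∉ (proj₂ x) F eq) ∷ u)
      regroup : p * (n ∸ length F) * c ≡ p ^ suc k * fallingFactorial (n ∸ length F) (suc k)
      regroup rewrite sym (ℕP.pred[m∸n]≡m∸[1+n] n (length F)) =
        solve 4 (λ p a pk f → p :* a :* (pk :* f) := p :* pk :* (a :* f)) refl
                p (n ∸ length F) (p ^ k) (fallingFactorial (ℕ.pred (n ∸ length F)) k)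
        where open +-*-Solver

    length-G : length (G p n) ≡ p ^ n * n !
    length-G = begin
      length (G p n)
        ≡⟨ length-filter≡count isColoredPerm? (allVecs (letters p n) n) ⟩
      count (λ w → does (isColoredPerm? w)) (allVecs (letters p n) n)
        ≡⟨ count-cong (allVecs (letters p n) n) (λ w _ → isColoredPerm≡fresh w) ⟩
      count (λ w → fresh [] (labels w)) (allVecs (letters p n) n)
        ≡⟨ count-fresh-allVecs n [] [] ⟩
      p ^ n * fallingFactorial n n
        ≡⟨ cong (p ^ n *_) (fallingFactorial-! n) ⟩
      p ^ n * n !
        ∎
      where
      open ≡-Reasoning
      isColoredPerm≡fresh : ∀ w → does (isColoredPerm? w) ≡ fresh [] (labels w)
      isColoredPerm≡fresh w with isColoredPerm? w
      ... | yes u = sym (fresh-complete [] (labels w) u (All.tabulate (λ _ ())))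
      ... | no ¬u with fresh [] (labels w) in eq
      ...   | true  = ⊥-elim (¬u (proj₁ (fresh-sound [] (labels w) eq)))
      ...   | false = refl

module Moves where

  open import Data.Nat using (ℕ; zero; suc; NonZero; _+_; _∸_; _%_)
  import Data.Nat.Properties as ℕP
  open import Data.Nat.DivMod using (_mod_; %-distribˡ-+; m%n%n≡m%n; [m+n]%n≡m%n; m<n⇒m%n≡m; n%n≡0)
  open import Data.Fin as F using (Fin; toℕ; punchIn; punchOut)
  import Data.Fin.Properties as FinP
  open import Data.Product using (_×_; _,_; proj₁; proj₂)
  open import Data.List as L using (List; []; _∷_; [_]; map; concatMap; allFin)
  import Data.List.Properties as LP
  open import Data.List.Membership.Propositional using (_∈_)
  open import Data.List.Membership.Propositional.Properties using (∈-map⁺; ∈-concatMap⁺; ∈-allFin)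
  open import Data.List.Relation.Unary.Any as Any using (here; there)
  open import Data.List.Relation.Unary.Unique.Propositional using (Unique)
  import Data.List.Relation.Unary.Unique.Propositional.Properties as UniqueP
  open import Data.Vec as V using (toList; lookup)
  import Data.Vec.Properties as VecP
  open import Relation.Nullary using (yes; no)
  open import Relation.Binary.PropositionalEquality hiding ([_])
  open import Data.Empty using (⊥-elim)
  open import Function using (_∘_)
  open import Defs

  toList-tabulate : ∀ {A : Set} {k} (f : Fin k → A) → toList (V.tabulate f) ≡ L.tabulate f
  toList-tabulate {k = zero}  f = refl
  toList-tabulate {k = suc k} f = cong (f F.zero ∷_) (toList-tabulate (f ∘ F.suc))

  module Colours (p : ℕ) .{{_ : NonZero p}} where
    _⊖_ : Fin p → Fin p → Fin p
    c ⊖ j = (toℕ c + (p ∸ toℕ j)) mod p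

    private
      toℕ-mod : ∀ a → toℕ (a mod p) ≡ a % p
      toℕ-mod a = FinP.toℕ-fromℕ< _

      toℕ-c0 : toℕ (c0 p) ≡ 0
      toℕ-c0 = c0≡zero p
        where
        c0≡zero : ∀ q .{{_ : NonZero q}} → toℕ (c0 q) ≡ 0
        c0≡zero (suc _) = refl

      +-%-idemʳ : ∀ a b → (a + b % p) % p ≡ (a + b) % p
      +-%-idemʳ a b = trans (%-distribˡ-+ a (b % p) p)
        (trans (cong (λ t → (a % p + t) % p) (m%n%n≡m%n b p)) (sym (%-distribˡ-+ a b p)))

    ⊕-⊖ : ∀ j c → j ⊕ (c ⊖ j) ≡ c
    ⊕-⊖ j c = FinP.toℕ-injective (begin
      toℕ (j ⊕ (c ⊖ j))                           ≡⟨ toℕ-mod _ ⟩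
      (toℕ j + toℕ (c ⊖ j)) % p                   ≡⟨ cong (λ t → (toℕ j + t) % p) (toℕ-mod _) ⟩
      (toℕ j + (toℕ c + (p ∸ toℕ j)) % p) % p     ≡⟨ +-%-idemʳ (toℕ j) _ ⟩
      (toℕ j + (toℕ c + (p ∸ toℕ j))) % p         ≡⟨ cong (_% p) j+[c+[p∸j]]≡c+p ⟩
      (toℕ c + p) % p                             ≡⟨ [m+n]%n≡m%n (toℕ c) p ⟩
      toℕ c % p                                   ≡⟨ m<n⇒m%n≡m (FinP.toℕ<n c) ⟩
      toℕ c                                       ∎)
      where
      open ≡-Reasoning
      j+[c+[p∸j]]≡c+p : toℕ j + (toℕ c + (p ∸ toℕ j)) ≡ toℕ c + p
      j+[c+[p∸j]]≡c+p = begin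
        toℕ j + (toℕ c + (p ∸ toℕ j))   ≡⟨ sym (ℕP.+-assoc (toℕ j) _ _) ⟩
        toℕ j + toℕ c + (p ∸ toℕ j)     ≡⟨ cong (_+ (p ∸ toℕ j)) (ℕP.+-comm (toℕ j) (toℕ c)) ⟩
        toℕ c + toℕ j + (p ∸ toℕ j)     ≡⟨ ℕP.+-assoc (toℕ c) _ _ ⟩
        toℕ c + (toℕ j + (p ∸ toℕ j))   ≡⟨ cong (toℕ c +_) (ℕP.m+[n∸m]≡n (ℕP.<⇒≤ (FinP.toℕ<n j))) ⟩
        toℕ c + p                       ∎

    c0-⊕ : ∀ c → c0 p ⊕ c ≡ c
    c0-⊕ c = FinP.toℕ-injective
      (trans (toℕ-mod _) (trans (cong (λ t → (t + toℕ c) % p) toℕ-c0) (m<n⇒m%n≡m (FinP.toℕ<n c))))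

    ⊖-self : ∀ c → c ⊖ c ≡ c0 p
    ⊖-self c = FinP.toℕ-injective
      (trans (toℕ-mod _) (trans (cong (_% p) (ℕP.m+[n∸m]≡n (ℕP.<⇒≤ (FinP.toℕ<n c)))) (trans (n%n≡0 p) (sym toℕ-c0))))

  -- The word move i j = (0,2)⋯(j,1)⋯(0,n), with (j,1) at position i, is one of the shuffles in B₁;
  -- unmove i j w is the unique v with (move i j) · v = w.
  module Move (p m : ℕ) .{{_ : NonZero p}} where
    open Colours p
    n = suc m

    move-letter : Fin n → Fin p → Fin n → Letter p n
    move-letter i j ℓ with i F.≟ ℓ
    ... | yes _   = (j , F.zero)
    ... | no  i≢ℓ = (c0 p , F.suc (punchOut i≢ℓ))

    move : Fin n → Fin p → Word p n
    move i j = V.tabulate (move-letter i j)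

    relabel : Fin n → Fin n → Fin n
    relabel i F.zero    = i
    relabel i (F.suc r) = punchIn i r

    unmove-letter : Fin n → Fin p → Letter p n → Letter p n
    unmove-letter i j (c , F.zero)  = (c ⊖ j , i)
    unmove-letter i j (c , F.suc r) = (c , punchIn i r)

    unmove : Fin n → Fin p → Word p n → Word p n
    unmove i j w = V.map (unmove-letter i j) w

    move-letter-at : ∀ i j → move-letter i j i ≡ (j , F.zero)
    move-letter-at i j with i F.≟ i
    ... | yes _   = refl
    ... | no  i≢i = ⊥-elim (i≢i refl)

    move-letter-punchIn : ∀ i j r → move-letter i j (punchIn i r) ≡ (c0 p , F.suc r)
    move-letter-punchIn i j r with i F.≟ punchIn i r
    ... | yes eq  = ⊥-elim (FinP.punchInᵢ≢i i r (sym eq))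
    ... | no  i≢ℓ = cong (λ t → (c0 p , F.suc t)) (trans (FinP.punchOut-cong i refl) (FinP.punchOut-punchIn i))

    move-unmove : ∀ i j w → move i j · unmove i j w ≡ w
    move-unmove i j w = trans (sym (VecP.map-∘ _ (unmove-letter i j) w)) (trans (VecP.map-cong
      (λ { (c , F.zero)  → trans (cong (λ t → (proj₁ t ⊕ (c ⊖ j) , proj₂ t))
                                       (trans (VecP.lookup∘tabulate (move-letter i j) i) (move-letter-at i j)))
                                 (cong (_, F.zero) (⊕-⊖ j c))
         ; (c , F.suc r) → trans (cong (λ t → (proj₁ t ⊕ c , proj₂ t))
                                       (trans (VecP.lookup∘tabulate (move-letter i j) (punchIn i r)) (move-letter-punchIn i j r)))
                                 (cong (_, F.suc r) (c0-⊕ c)) }) w) (VecP.map-id w))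

    relabel-injective : ∀ i {a b} → relabel i a ≡ relabel i b → a ≡ b
    relabel-injective i {F.zero} {F.zero} e = refl
    relabel-injective i {F.zero} {F.suc b} e = ⊥-elim (FinP.punchInᵢ≢i i b (sym e))
    relabel-injective i {F.suc a} {F.zero} e = ⊥-elim (FinP.punchInᵢ≢i i a e)
    relabel-injective i {F.suc a} {F.suc b} e = cong F.suc (FinP.punchIn-injective i a b e)

    unmove-letter-label : ∀ i j x → proj₂ (unmove-letter i j x) ≡ relabel i (proj₂ x)
    unmove-letter-label i j (c , F.zero) = refl
    unmove-letter-label i j (c , F.suc r) = refl

    unmove-perm : ∀ i j w → IsColoredPerm w → IsColoredPerm (unmove i j w)
    unmove-perm i j w u = subst Unique (sym labels-unmove) (UniqueP.map⁺ (relabel-injective i) u)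
      where
      labels-unmove : map proj₂ (toList (unmove i j w)) ≡ map (relabel i) (map proj₂ (toList w))
      labels-unmove = trans (cong (map proj₂) (VecP.toList-map (unmove-letter i j) w))
          (trans (sym (LP.map-∘ (toList w))) (trans (LP.map-cong (unmove-letter-label i j) (toList w)) (LP.map-∘ (toList w))))

    move-letter-label-injective : ∀ i j {a b} → proj₂ (move-letter i j a) ≡ proj₂ (move-letter i j b) → a ≡ b
    move-letter-label-injective i j {a} {b} e with i F.≟ a | i F.≟ b
    ... | yes refl | yes refl = refl
    ... | yes _ | no _ = ⊥-elim (FinP.0≢1+n e)
    ... | no _ | yes _ = ⊥-elim (FinP.0≢1+n (sym e))
    ... | no i≢a | no i≢b = FinP.punchOut-injective i≢a i≢b (FinP.suc-injective e)

    move-perm : ∀ i j → IsColoredPerm (move i j)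
    move-perm i j = subst Unique (sym labels-move) (UniqueP.tabulate⁺ (move-letter-label-injective i j))
      where
      labels-move : map proj₂ (toList (move i j)) ≡ L.tabulate (proj₂ ∘ move-letter i j)
      labels-move = trans (cong (map proj₂) (toList-tabulate (move-letter i j))) (LP.map-tabulate (move-letter i j) proj₂)

    move-injective : ∀ {i j i′ j′} → move i j ≡ move i′ j′ → i ≡ i′ × j ≡ j′
    move-injective {i} {j} {i′} {j′} e = from-letter-at-i (begin
      (j , F.zero)               ≡⟨ sym (move-letter-at i j) ⟩
      move-letter i j i          ≡⟨ sym (VecP.lookup∘tabulate (move-letter i j) i) ⟩
      lookup (move i j) i        ≡⟨ cong (λ v → lookup v i) e ⟩
      lookup (move i′ j′) i      ≡⟨ VecP.lookup∘tabulate (move-letter i′ j′) i ⟩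
      move-letter i′ j′ i        ∎)
      where
      open ≡-Reasoning
      from-letter-at-i : (j , F.zero) ≡ move-letter i′ j′ i → i ≡ i′ × j ≡ j′
      from-letter-at-i e′ with i′ F.≟ i
      from-letter-at-i refl | yes refl = refl , refl
      from-letter-at-i ()   | no _

    ∷-∈-shuffle : ∀ {A : Set} (x : A) ys → (x ∷ ys) ∈ shuffle [ x ] ys
    ∷-∈-shuffle x [] = here refl
    ∷-∈-shuffle x (y ∷ ys) = here refl

    tabulate-∈-shuffle : ∀ {A : Set} {k} (i : Fin (suc k)) (f : Fin (suc k) → A) x → f i ≡ x →
                         L.tabulate f ∈ shuffle [ x ] (L.tabulate (f ∘ punchIn i))
    tabulate-∈-shuffle F.zero f x refl = ∷-∈-shuffle (f F.zero) (L.tabulate (f ∘ F.suc))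
    tabulate-∈-shuffle {k = suc k} (F.suc i) f x eq = there (∈-map⁺ (f F.zero ∷_) (tabulate-∈-shuffle i (f ∘ F.suc) x eq))

    length-shuffle-[_] : ∀ {A : Set} (x : A) ys → L.length (shuffle [ x ] ys) ≡ suc (L.length ys)
    length-shuffle-[ x ] []       = refl
    length-shuffle-[ x ] (y ∷ ys) = cong suc (trans (LP.length-map (y ∷_) (shuffle [ x ] ys)) (length-shuffle-[ x ] ys))

    shuffles : List (List (Letter p n))
    shuffles = concatMap (λ j → shuffle [ (j , F.zero) ] (W₁ p n)) (allFin p)

    move-∈-shuffles : ∀ i j → toList (move i j) ∈ shuffles
    move-∈-shuffles i j = ∈-concatMap⁺ (λ j → shuffle [ (j , F.zero) ] (W₁ p n)) (Any.map (λ { refl → mem }) (∈-allFin j))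
      where
      rest≡W₁ : L.tabulate (move-letter i j ∘ punchIn i) ≡ W₁ p n
      rest≡W₁ = trans (LP.tabulate-cong (move-letter-punchIn i j)) (sym (LP.map-tabulate (λ x → x) (λ r → (c0 p , F.suc r))))
      mem : toList (move i j) ∈ shuffle [ (j , F.zero) ] (W₁ p n)
      mem = subst₂ (λ a b → a ∈ shuffle [ (j , F.zero) ] b) (sym (toList-tabulate (move-letter i j))) rest≡W₁
                   (tabulate-∈-shuffle i (move-letter i j) _ (move-letter-at i j))



module GroupAlgebra (p n : ℕ) .{{_ : NonZero p}} where

  open import Data.Rational using (0ℚ; 1ℚ; _*_; _≤_)
  import Data.Rational.Properties as ℚP
  open import Relation.Binary.PropositionalEquality
  open import Defs
  open Fractions
  open Sums
  open Enumeration

  NonNeg : ℚG p n → Set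
  NonNeg x = ∀ w → 0ℚ ≤ x w

  0≤⋆ : ∀ y x → NonNeg y → NonNeg x → NonNeg (y ⋆ x)
  0≤⋆ y x 0≤y 0≤x w =
    0≤Σ (G p n) (λ u _ → 0≤Σ (G p n) (λ v _ → 0≤-* (0≤-* (0≤y u) (0≤x v)) (0≤δ (u · v) w)))

  mass-⋆≤1 : ∀ y x → NonNeg y → NonNeg x →
             Σℚ (G p n) y ≤ 1ℚ → Σℚ (G p n) x ≤ 1ℚ → Σℚ (G p n) (y ⋆ x) ≤ 1ℚ
  mass-⋆≤1 y x 0≤y 0≤x Σy≤1 Σx≤1 = begin
    Σℚ Gₙ (y ⋆ x)
      ≡⟨ Σ-swap Gₙ Gₙ (λ w u → Σℚ Gₙ (λ v → y u * x v * δ (u · v) w)) ⟩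
    Σℚ Gₙ (λ u → Σℚ Gₙ (λ w → Σℚ Gₙ (λ v → y u * x v * δ (u · v) w)))
      ≡⟨ Σ-cong Gₙ (λ u _ → trans (Σ-swap Gₙ Gₙ (λ w v → y u * x v * δ (u · v) w))
                                   (Σ-cong Gₙ (λ v _ → Σ-*ˡ Gₙ (y u * x v) (δ (u · v))))) ⟩
    Σℚ Gₙ (λ u → Σℚ Gₙ (λ v → y u * x v * Σℚ Gₙ (δ (u · v))))
      ≤⟨ Σ-mono-≤ Gₙ (λ u _ → Σ-mono-≤ Gₙ (λ v _ → drop-δ u v)) ⟩
    Σℚ Gₙ (λ u → Σℚ Gₙ (λ v → y u * x v))
      ≡⟨ Σ-cong Gₙ (λ u _ → Σ-*ˡ Gₙ (y u) x) ⟩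
    Σℚ Gₙ (λ u → y u * Σℚ Gₙ x)
      ≤⟨ Σ-mono-≤ Gₙ (λ u _ → subst (y u * Σℚ Gₙ x ≤_) (ℚP.*-identityʳ (y u))
                                     (*-monoʳ-≤-0≤ (y u) (0≤y u) Σx≤1)) ⟩
    Σℚ Gₙ y
      ≤⟨ Σy≤1 ⟩
    1ℚ ∎
    where
    open ℚP.≤-Reasoning
    Gₙ = G p n
    drop-δ : ∀ u v → y u * x v * Σℚ Gₙ (δ (u · v)) ≤ y u * x v
    drop-δ u v = subst (y u * x v * Σℚ Gₙ (δ (u · v)) ≤_) (ℚP.*-identityʳ _)
      (*-monoʳ-≤-0≤ _ (0≤-* (0≤y u) (0≤x v)) (Σδ≤1 (u · v) Gₙ (Unique-G p n)))

module TopToRandom (p m : ℕ) .{{_ : NonZero p}} where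

  open import Data.Nat as ℕ using (ℕ; zero; suc; NonZero; _*_)
  import Data.Nat.Properties as ℕP
  open import Data.Integer using (+_)
  open import Data.Fin as F using (Fin)
  open import Data.Product using (_×_; _,_; proj₁; proj₂)
  open import Data.Bool using (Bool; true; if_then_else_)
  open import Data.List as L using (List; _∷_; map; allFin; cartesianProduct; filter; length)
  import Data.List.Properties as LP
  open import Data.List.Membership.Propositional using (_∈_)
  open import Data.List.Membership.Propositional.Properties using (∈-filter⁺; ∈-map⁻)
  open import Data.List.Relation.Unary.Unique.Propositional using (Unique)
  import Data.List.Relation.Unary.Unique.Propositional.Properties as UniqueP
  open import Data.Vec using (toList)
  import Data.Vec.Properties as VecP
  open import Data.Rational as ℚ using (ℚ; 0ℚ; 1ℚ; _/_; _≤_)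
  import Data.Rational.Properties as ℚP
  open import Relation.Nullary using (yes; does)
  open import Relation.Binary.PropositionalEquality hiding ([_])
  open import Defs
  open Fractions
  open Sums
  open Counting
  open Enumeration
  open Moves
  open Move p m public
  open GroupAlgebra p n

  T : ℚG p n
  T = topToRandom p n

  weight : ℚ
  weight = _/_ (+ 1) (p * n) {{ℕP.m*n≢0 p n}}

  multiplicity : Word p n → ℕ
  multiplicity u = length (filter (λ l → l ≟Ls toList u) shuffles)

  -- T u unfolds definitionally to weight ℚ.* fromℕ (multiplicity u).
  0≤T : NonNeg T
  0≤T u = 0≤-* (0≤/ 1 (p * n) {{ℕP.m*n≢0 p n}}) (0≤fromℕ (multiplicity u))

  0≤weight : 0ℚ ≤ weight
  0≤weight = 0≤/ 1 (p * n) {{ℕP.m*n≢0 p n}}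

  weight≤T-move : ∀ i j → weight ≤ T (move i j)
  weight≤T-move i j = subst (_≤ T (move i j)) (ℚP.*-identityʳ weight)
    (*-monoʳ-≤-0≤ weight 0≤weight (fromℕ-mono-≤ {1} {multiplicity (move i j)} occurs))
    where
    occurs : 1 ℕ.≤ multiplicity (move i j)
    occurs with filter (λ l → l ≟Ls toList (move i j)) shuffles
              | ∈-filter⁺ (λ l → l ≟Ls toList (move i j)) (move-∈-shuffles i j) refl
    ... | _ ∷ _ | _ = ℕ.s≤s ℕ.z≤n

  length-shuffles : length shuffles ≡ p * n
  length-shuffles = begin
    length shuffles                                    ≡⟨ length-concatMap _ (allFin p) ⟩
    Σℕ (allFin p) (λ j → length (shuffle L.[ (j , F.zero) ] (W₁ p n)))
      ≡⟨ Σℕ-cong (allFin p) (λ j _ → trans (length-shuffle-[ (j , F.zero) ] (W₁ p n)) (cong suc length-W₁)) ⟩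
    Σℕ (allFin p) (λ _ → n)                            ≡⟨ Σℕ-const (allFin p) n ⟩
    length (allFin p) * n                              ≡⟨ cong (_* n) (LP.length-tabulate {n = p} (λ x → x)) ⟩
    p * n                                              ∎
    where
    open ≡-Reasoning
    length-W₁ : length (W₁ p n) ≡ m
    length-W₁ = trans (LP.length-map _ (allFin m)) (LP.length-tabulate {n = m} (λ x → x))

  -- Every shuffle is the word of at most one element of G.
  Σ-multiplicity≤length : Σℕ (G p n) multiplicity ℕ.≤ length shuffles
  Σ-multiplicity≤length = ℕP.≤-trans (ℕP.≤-reflexive swap)
    (ℕP.≤-trans (Σℕ-mono-≤ shuffles (λ l _ → at-most-one l))
                (ℕP.≤-reflexive (trans (Σℕ-const shuffles 1) (ℕP.*-identityʳ _))))
    where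
    is : List (Letter p n) → Word p n → Bool
    is l u = does (l ≟Ls toList u)
    is-sound : ∀ l u → is l u ≡ true → l ≡ toList u
    is-sound l u e with l ≟Ls toList u
    ... | yes eq = eq
    swap : Σℕ (G p n) multiplicity ≡ Σℕ shuffles (λ l → count (is l) (G p n))
    swap = trans (Σℕ-cong (G p n) (λ u _ → trans (length-filter≡count (λ l → l ≟Ls toList u) shuffles)
                                                 (count≡Σℕ _ shuffles)))
           (trans (Σℕ-swap (G p n) shuffles (λ u l → if is l u then 1 else 0))
                  (Σℕ-cong shuffles (λ l _ → sym (count≡Σℕ (is l) (G p n)))))
    at-most-one : ∀ l → count (is l) (G p n) ℕ.≤ 1
    at-most-one l = count≤1 (is l) (G p n) (Unique-G p n) (λ x y _ _ ex ey →
      trans (sym (VecP.cast-is-id refl x)) (VecP.toList-injective refl x y (trans (sym (is-sound l x ex)) (is-sound l y ey))))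

  ΣT≤1 : Σℚ (G p n) T ≤ 1ℚ
  ΣT≤1 = begin
    Σℚ (G p n) T                                          ≡⟨ Σ-*ˡ (G p n) weight (λ u → fromℕ (multiplicity u)) ⟩
    weight ℚ.* Σℚ (G p n) (λ u → fromℕ (multiplicity u))  ≡⟨ cong (weight ℚ.*_) (Σ-fromℕ (G p n) multiplicity) ⟩
    weight ℚ.* fromℕ (Σℕ (G p n) multiplicity)            ≤⟨ *-monoʳ-≤-0≤ weight 0≤weight (fromℕ-mono-≤ Σ-multiplicity≤pn) ⟩
    weight ℚ.* fromℕ (p * n)                              ≡⟨ 1/n*n≡1 (p * n) {{ℕP.m*n≢0 p n}} ⟩
    1ℚ                                                    ∎
    where
    open ℚP.≤-Reasoning
    Σ-multiplicity≤pn : Σℕ (G p n) multiplicity ℕ.≤ p * n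
    Σ-multiplicity≤pn = ℕP.≤-trans Σ-multiplicity≤length (ℕP.≤-reflexive length-shuffles)

  moves : List (Word p n)
  moves = map (λ ij → move (proj₁ ij) (proj₂ ij)) (cartesianProduct (allFin n) (allFin p))

  Unique-moves : Unique moves
  Unique-moves = UniqueP.map⁺ (λ {a} {b} → injective a b) (UniqueP.cartesianProduct⁺ (UniqueP.allFin⁺ n) (UniqueP.allFin⁺ p))
    where
    injective : ∀ (a b : Fin n × Fin p) → move (proj₁ a) (proj₂ a) ≡ move (proj₁ b) (proj₂ b) → a ≡ b
    injective (i , j) (i′ , j′) e with move-injective e
    ... | refl , refl = refl

  moves⊆G : ∀ u → u ∈ moves → u ∈ G p n
  moves⊆G u u∈moves with ∈-map⁻ _ u∈moves
  ... | (i , j) , _ , refl = ∈-G⁺ p n (move i j) (move-perm i j)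

  -- Only the terms u = move i j of (T ⋆ x) w are kept, each with v = unmove i j w.
  Σ-unmove≤T⋆ : ∀ x → NonNeg x → ∀ w → w ∈ G p n →
                Σℚ (allFin n) (λ i → Σℚ (allFin p) (λ j → weight ℚ.* x (unmove i j w))) ≤ (T ⋆ x) w
  Σ-unmove≤T⋆ x 0≤x w w∈G = begin
    Σℚ (allFin n) (λ i → Σℚ (allFin p) (λ j → weight ℚ.* x (unmove i j w)))
      ≤⟨ Σ-mono-≤ (allFin n) (λ i _ → Σ-mono-≤ (allFin p) (λ j _ → term-move i j)) ⟩
    Σℚ (allFin n) (λ i → Σℚ (allFin p) (λ j → term (move i j)))
      ≡⟨ sym (trans (Σ-map _ (cartesianProduct (allFin n) (allFin p)) term)
                    (Σ-cartesianProduct (allFin n) (allFin p) (λ ij → term (move (proj₁ ij) (proj₂ ij))))) ⟩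
    Σℚ moves term
      ≤⟨ Σ-⊆-mono-≤ moves (G p n) term Unique-moves moves⊆G (λ u _ → 0≤term u) ⟩
    (T ⋆ x) w ∎
    where
    open ℚP.≤-Reasoning
    term : Word p n → ℚ
    term u = Σℚ (G p n) (λ v → T u ℚ.* x v ℚ.* δ (u · v) w)
    0≤term : ∀ u → 0ℚ ≤ term u
    0≤term u = 0≤Σ (G p n) (λ v _ → 0≤-* (0≤-* (0≤T u) (0≤x v)) (0≤δ (u · v) w))
    term-move : ∀ i j → weight ℚ.* x (unmove i j w) ≤ term (move i j)
    term-move i j = ℚP.≤-trans (*-monoˡ-≤-0≤ (x (unmove i j w)) (0≤x _) (weight≤T-move i j))
      (subst (_≤ term (move i j))
             (trans (cong (λ t → T (move i j) ℚ.* x (unmove i j w) ℚ.* δ t w) (move-unmove i j w))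
                    (trans (cong (T (move i j) ℚ.* x (unmove i j w) ℚ.*_) (δ-refl w)) (ℚP.*-identityʳ _)))
             (∈⇒≤Σ (G p n) (unmove i j w) (∈-G⁺ p n _ (unmove-perm i j w (∈-G⁻ p n w∈G)))
                   (λ v _ → 0≤-* (0≤-* (0≤T (move i j)) (0≤x v)) (0≤δ (move i j · v) w))))

module OrderedTail (p m : ℕ) .{{_ : NonZero p}} where

  open import Data.Nat as ℕ using (suc; zero; _+_; _∸_; _≤_; _<_; _≤?_; _<?_; z≤n; s≤s)
  import Data.Nat.Properties as ℕP
  open import Data.Fin as F using (Fin; toℕ; punchIn)
  import Data.Fin.Properties as FinP
  open import Data.Product using (_×_; _,_; proj₁; proj₂; ∃)
  import Data.Product.Properties as ProdP
  open import Data.List as L using (List; []; _∷_; _++_; map; filter; length)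
  import Data.List.Properties as LP
  open import Data.List.Membership.Propositional using (_∈_; _∉_)
  open import Data.List.Membership.Propositional.Properties using (∈-map⁺; ∈-map⁻; ∈-∃++; ∈-++⁺ʳ)
  open import Data.List.Relation.Unary.Any using (here; there)
  open import Data.List.Relation.Unary.All as All using (All)
  import Data.List.Relation.Unary.All.Properties as AllP
  open import Data.List.Relation.Unary.Unique.Propositional using (Unique; _∷_)
  open import Data.Vec using (toList)
  import Data.Vec.Properties as VecP
  open import Relation.Nullary using (Dec; yes; no)
  open import Relation.Binary.PropositionalEquality hiding ([_])
  open import Data.Empty using (⊥-elim)
  open import Function using (_∘_)
  open import Defs
  open Counting
  open Enumeration
  open GroupOrder using (_∈ᵇ_; ∈ᵇ⇒∈; count-∈ᵇ-allFin)
  open Moves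
  open Move p m
  open Colours p

  label : Letter p n → ℕ
  label x = toℕ (proj₂ x)

  label≥? : ∀ k → (x : Letter p n) → Dec (k ≤ label x)
  label≥? k x = k ≤? label x

  forget : Letter p n → Fin p × ℕ
  forget (c , ℓ) = (c , toℕ ℓ)

  forget-injective : ∀ {x y} → forget x ≡ forget y → x ≡ y
  forget-injective {c , a} {d , b} e = cong₂ _,_ (ProdP.,-injectiveˡ e) (FinP.toℕ-injective (ProdP.,-injectiveʳ e))

  run : ℕ → ℕ → List (Fin p × ℕ)
  run a zero    = []
  run a (suc t) = (c0 p , a) ∷ run (suc a) t

  -- The letters with label ≥ k (0-based: the cards k+1, …, n) occur in increasing order, all with colour 0.
  OrderedFrom : ℕ → List (Letter p n) → Set
  OrderedFrom k xs = map forget (filter (label≥? k) xs) ≡ run k (n ∸ k)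

  orderedFrom? : ∀ k xs → Dec (OrderedFrom k xs)
  orderedFrom? k xs = LP.≡-dec (ProdP.≡-dec FinP._≟_ ℕ._≟_) _ _

  orderedFrom-n : ∀ xs → OrderedFrom n xs
  orderedFrom-n xs rewrite LP.filter-none (label≥? n) (All.tabulate {xs = xs} (λ {x} _ → ℕP.<⇒≱ (FinP.toℕ<n (proj₂ x))))
                         | ℕP.n∸n≡0 n = refl

  orderedFrom-0⇒e : ∀ w → OrderedFrom 0 (toList w) → w ≡ e p n
  orderedFrom-0⇒e w ordered = trans (sym (VecP.cast-is-id refl w))
    (VecP.toList-injective refl w (e p n) (LP.map-injective forget-injective (begin
      map forget (toList w)                            ≡⟨ cong (map forget) (sym (LP.filter-all (label≥? 0) all-≥0)) ⟩
      map forget (filter (label≥? 0) (toList w))       ≡⟨ ordered ⟩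
      run 0 n                                          ≡⟨ sym forget-e ⟩
      map forget (toList (e p n))                      ∎)))
    where
    open ≡-Reasoning
    all-≥0 : All (λ x → 0 ≤ label x) (toList w)
    all-≥0 = All.tabulate (λ _ → z≤n)
    tabulate-run : ∀ a k → L.tabulate {n = k} (λ i → (c0 p , a + toℕ i)) ≡ run a k
    tabulate-run a zero    = refl
    tabulate-run a (suc k) = cong₂ _∷_ (cong (c0 p ,_) (ℕP.+-identityʳ a))
      (trans (LP.tabulate-cong (λ i → cong (c0 p ,_) (ℕP.+-suc a (toℕ i)))) (tabulate-run (suc a) k))
    forget-e : map forget (toList (e p n)) ≡ run 0 n
    forget-e = trans (cong (map forget) (toList-tabulate (λ i → (c0 p , i))))
                     (trans (LP.map-tabulate (λ i → (c0 p , i)) forget) (tabulate-run 0 n))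

  private
    filter-∷-cong : ∀ k x {xs ys} → filter (label≥? k) xs ≡ filter (label≥? k) ys →
                    filter (label≥? k) (x ∷ xs) ≡ filter (label≥? k) (x ∷ ys)
    filter-∷-cong k x eq with label≥? k x
    ... | yes k≤x = trans (LP.filter-accept (label≥? k) k≤x)
                          (trans (cong (x ∷_) eq) (sym (LP.filter-accept (label≥? k) k≤x)))
    ... | no  k≰x = trans (LP.filter-reject (label≥? k) k≰x) (trans eq (sym (LP.filter-reject (label≥? k) k≰x)))

    punchIn-≥ : ∀ {k} (i : Fin (suc k)) (r : Fin k) → toℕ i ≤ toℕ r → punchIn i r ≡ F.suc r
    punchIn-≥ F.zero    r         le      = refl
    punchIn-≥ (F.suc i) (F.suc r) (s≤s le) = cong F.suc (punchIn-≥ i r le)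

    punchIn-< : ∀ {k} (i : Fin (suc k)) (r : Fin k) → toℕ r < toℕ i → toℕ (punchIn i r) ≡ toℕ r
    punchIn-< (F.suc i) F.zero    lt       = refl
    punchIn-< (F.suc i) (F.suc r) (s≤s lt) = cong suc (punchIn-< i r lt)

  -- For i < k, unmove i j fixes every letter with label ≥ k and keeps all others below k.
  filter-unmove-< : ∀ i j k → toℕ i < k → ∀ xs →
                    filter (label≥? k) (map (unmove-letter i j) xs) ≡ filter (label≥? k) xs
  filter-unmove-< i j k i<k []                   = refl
  filter-unmove-< i j k i<k ((c , F.zero) ∷ xs)  =
    trans (LP.filter-reject (label≥? k) (ℕP.<⇒≱ i<k))
          (trans (filter-unmove-< i j k i<k xs) (sym (LP.filter-reject (label≥? k) (ℕP.<⇒≱ (ℕP.≤-<-trans z≤n i<k)))))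
  filter-unmove-< i j k i<k ((c , F.suc r) ∷ xs) with toℕ r <? toℕ i
  ... | yes r<i = trans (LP.filter-reject (label≥? k)
                          (λ k≤ → ℕP.<⇒≱ (ℕP.<-trans r<i i<k) (subst (k ≤_) (punchIn-< i r r<i) k≤)))
                        (trans (filter-unmove-< i j k i<k xs)
                               (sym (LP.filter-reject (label≥? k) (ℕP.<⇒≱ (ℕP.≤-<-trans r<i i<k)))))
  ... | no  r≮i rewrite punchIn-≥ i r (ℕP.≮⇒≥ r≮i) = filter-∷-cong k (c , F.suc r) (filter-unmove-< i j k i<k xs)

  orderedFrom-unmove-< : ∀ i j k → toℕ i < k → ∀ w → OrderedFrom k (toList w) → OrderedFrom k (toList (unmove i j w))
  orderedFrom-unmove-< i j k i<k w ordered =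
    trans (cong (map forget ∘ filter (label≥? k)) (VecP.toList-map (unmove-letter i j) w))
          (trans (cong (map forget) (filter-unmove-< i j k i<k (toList w))) ordered)

  private
    ∉-middle : ∀ {A : Set} (as : List A) {z bs} → Unique (as ++ z ∷ bs) → z ∉ as × z ∉ bs
    ∉-middle []       (z∉bs ∷ _) = (λ ()) , AllP.All¬⇒¬Any z∉bs
    ∉-middle (a ∷ as) (a∉ ∷ u)   with ∉-middle as u
    ... | z∉as , z∉bs = (λ { (here eq) → All.lookup a∉ (∈-++⁺ʳ as (here refl)) (sym eq) ; (there m) → z∉as m }) , z∉bs

    length-labels : ∀ (w : Word p n) → length (map proj₂ (toList w)) ≡ n
    length-labels w = trans (LP.length-map proj₂ (toList w)) (VecP.length-toList w)

  ∃-label-0 : ∀ w → IsColoredPerm w → ∃ λ c → (c , F.zero) ∈ toList w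
  ∃-label-0 w perm with ∈-map⁻ proj₂ (GroupOrder.Unique⇒∈ (map proj₂ (toList w)) perm (length-labels w) F.zero)
  ... | (c , _) , c∈w , refl = c , c∈w

  -- For k ≤ i, unmove i j shifts the labels k+1, …, i down by one and fixes the labels above i.
  filter-unmove-≥ : ∀ i j k → k ≤ toℕ i → ∀ ys → (∀ y → y ∈ ys → proj₂ y ≢ F.zero) →
                    filter (label≥? k) (map (unmove-letter i j) ys) ≡ map (unmove-letter i j) (filter (label≥? (suc k)) ys)
  filter-unmove-≥ i j k k≤i []                   nz = refl
  filter-unmove-≥ i j k k≤i ((c , F.zero) ∷ ys)  nz = ⊥-elim (nz _ (here refl) refl)
  filter-unmove-≥ i j k k≤i ((c , F.suc r) ∷ ys) nz with toℕ r <? toℕ i | k ≤? toℕ r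
  ... | yes r<i | yes k≤r =
    trans (LP.filter-accept (label≥? k) (subst (k ≤_) (sym (punchIn-< i r r<i)) k≤r))
          (trans (cong (unmove-letter i j (c , F.suc r) ∷_) rest)
                 (cong (map (unmove-letter i j)) (sym (LP.filter-accept (label≥? (suc k)) {x = c , F.suc r} {xs = ys} (s≤s k≤r)))))
    where rest = filter-unmove-≥ i j k k≤i ys (λ y m → nz y (there m))
  ... | yes r<i | no  k≰r =
    trans (LP.filter-reject (label≥? k) (λ k≤ → k≰r (subst (k ≤_) (punchIn-< i r r<i) k≤)))
          (trans rest (cong (map (unmove-letter i j))
                            (sym (LP.filter-reject (label≥? (suc k)) {x = c , F.suc r} {xs = ys} (λ { (s≤s k≤r) → k≰r k≤r })))))
    where rest = filter-unmove-≥ i j k k≤i ys (λ y m → nz y (there m))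
  ... | no  r≮i | _ =
    trans (LP.filter-accept (label≥? k) (subst (λ t → k ≤ toℕ t) (sym (punchIn-≥ i r i≤r)) (ℕP.m≤n⇒m≤1+n k≤r)))
          (trans (cong (unmove-letter i j (c , F.suc r) ∷_) rest)
                 (cong (map (unmove-letter i j)) (sym (LP.filter-accept (label≥? (suc k)) {x = c , F.suc r} {xs = ys} (s≤s k≤r)))))
    where
    rest = filter-unmove-≥ i j k k≤i ys (λ y m → nz y (there m))
    i≤r = ℕP.≮⇒≥ r≮i
    k≤r = ℕP.≤-trans k≤i i≤r

  unmove-run-≤ : ∀ i j (ys : List (Letter p n)) a t → 1 ≤ a → a + t ≤ suc (toℕ i) →
                 map forget ys ≡ run a t → map forget (map (unmove-letter i j) ys) ≡ run (ℕ.pred a) t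
  unmove-run-≤ i j []                  a zero    _   _  _ = refl
  unmove-run-≤ i j ((c , F.zero) ∷ ys)  a (suc t) 1≤a _  e with ProdP.,-injectiveʳ (LP.∷-injectiveˡ e)
  ... | refl = ⊥-elim (ℕP.<-irrefl refl 1≤a)
  unmove-run-≤ i j ((c , F.suc r) ∷ ys) a (suc t) 1≤a le e
    with ProdP.,-injectiveˡ (LP.∷-injectiveˡ e) | ProdP.,-injectiveʳ (LP.∷-injectiveˡ e)
  ... | refl | refl = cong₂ _∷_ (cong (c0 p ,_) (punchIn-< i r r<i))
                                (unmove-run-≤ i j ys (suc (suc (toℕ r))) t (s≤s z≤n) le′ (LP.∷-injectiveʳ e))
    where
    le′ : suc (suc (toℕ r)) + t ≤ suc (toℕ i)
    le′ = subst (_≤ suc (toℕ i)) (ℕP.+-suc (suc (toℕ r)) t) le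
    r<i : toℕ r < toℕ i
    r<i = ℕP.≤-trans (ℕP.m≤m+n (suc (toℕ r)) t) (ℕP.≤-pred le′)

  unmove-run-> : ∀ i j (ys : List (Letter p n)) a t → suc (toℕ i) ≤ a →
                 map forget ys ≡ run a t → map forget (map (unmove-letter i j) ys) ≡ run a t
  unmove-run-> i j []                  a zero    _  _ = refl
  unmove-run-> i j ((c , F.zero) ∷ ys)  a (suc t) lt e with ProdP.,-injectiveʳ (LP.∷-injectiveˡ e)
  ... | refl = ⊥-elim (ℕP.<-irrefl refl (ℕP.≤-trans (s≤s z≤n) lt))
  unmove-run-> i j ((c , F.suc r) ∷ ys) a (suc t) lt e
    with ProdP.,-injectiveˡ (LP.∷-injectiveˡ e) | ProdP.,-injectiveʳ (LP.∷-injectiveˡ e)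
  ... | refl | refl rewrite punchIn-≥ i r (ℕP.≤-pred lt) =
    cong ((c0 p , suc (toℕ r)) ∷_) (unmove-run-> i j ys (suc (suc (toℕ r))) t (ℕP.m≤n⇒m≤1+n lt) (LP.∷-injectiveʳ e))

  run-++⁻ : ∀ (as bs : List (Fin p × ℕ)) a t → as ++ bs ≡ run a t →
            as ≡ run a (length as) × bs ≡ run (a + length as) (t ∸ length as) × length as ≤ t
  run-++⁻ []       bs a t       e rewrite ℕP.+-identityʳ a = refl , e , z≤n
  run-++⁻ (x ∷ as) bs a (suc t) e with LP.∷-injective e
  ... | refl , e′ with run-++⁻ as bs (suc a) t e′
  ... | as≡ , bs≡ , len≤ = cong (x ∷_) as≡
                         , trans bs≡ (cong (λ s → run s (t ∸ length as)) (sym (ℕP.+-suc a (length as))))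
                         , s≤s len≤

  run-++ : ∀ a R S → run a R ++ (c0 p , a + R) ∷ run (suc (a + R)) S ≡ run a (R + suc S)
  run-++ a zero    S rewrite ℕP.+-identityʳ a = refl
  run-++ a (suc R) S rewrite ℕP.+-suc a R     = cong ((c0 p , a) ∷_) (run-++ (suc a) R S)

  filter-unmove-around-0 : ∀ i c k → k ≤ toℕ i → ∀ as bs →
    (∀ y → y ∈ as → proj₂ y ≢ F.zero) → (∀ y → y ∈ bs → proj₂ y ≢ F.zero) →
    let ρ = unmove-letter i c in
    filter (label≥? k) (map ρ (as ++ (c , F.zero) ∷ bs))
      ≡ map ρ (filter (label≥? (suc k)) as) ++ ρ (c , F.zero) ∷ map ρ (filter (label≥? (suc k)) bs)
  filter-unmove-around-0 i c k k≤i as bs nzA nzB = begin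
      filter (label≥? k) (map ρ (as ++ x ∷ bs))
    ≡⟨ cong (filter (label≥? k)) (LP.map-++ ρ as (x ∷ bs)) ⟩
      filter (label≥? k) (map ρ as ++ ρ x ∷ map ρ bs)
    ≡⟨ LP.filter-++ (label≥? k) (map ρ as) _ ⟩
      filter (label≥? k) (map ρ as) ++ filter (label≥? k) (ρ x ∷ map ρ bs)
    ≡⟨ cong (filter (label≥? k) (map ρ as) ++_) (LP.filter-accept (label≥? k) {x = ρ x} {xs = map ρ bs} k≤i) ⟩
      filter (label≥? k) (map ρ as) ++ ρ x ∷ filter (label≥? k) (map ρ bs)
    ≡⟨ cong₂ (λ P Q → P ++ ρ x ∷ Q) (filter-unmove-≥ i c k k≤i as nzA) (filter-unmove-≥ i c k k≤i bs nzB) ⟩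
      map ρ (filter (label≥? (suc k)) as) ++ ρ x ∷ map ρ (filter (label≥? (suc k)) bs)
    ∎
    where
    open ≡-Reasoning
    x = (c , F.zero)
    ρ = unmove-letter i c

  orderedFrom-suc-around-0 : ∀ k c as bs → OrderedFrom (suc k) (as ++ (c , F.zero) ∷ bs) →
    map forget (filter (label≥? (suc k)) as) ++ map forget (filter (label≥? (suc k)) bs) ≡ run (suc k) (n ∸ suc k)
  orderedFrom-suc-around-0 k c as bs ordered = trans (sym (LP.map-++ forget Fa Fb))
    (trans (cong (map forget) (sym (trans (LP.filter-++ (label≥? (suc k)) as ((c , F.zero) ∷ bs))
                                          (cong (Fa ++_) (LP.filter-reject (label≥? (suc k)) {x = c , F.zero} {xs = bs} (λ ()))))))
           ordered)
    where
    Fa = filter (label≥? (suc k)) as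
    Fb = filter (label≥? (suc k)) bs

  -- The letter with label 0 is relabelled k + R, R the number of letters with label > k in front of it,
  -- so that it extends the run of letters > k.
  orderedFrom-unmove-split : ∀ k c as bs → suc k ≤ n →
    (∀ y → y ∈ as → proj₂ y ≢ F.zero) → (∀ y → y ∈ bs → proj₂ y ≢ F.zero) →
    OrderedFrom (suc k) (as ++ (c , F.zero) ∷ bs) →
    ∃ λ i → k ≤ toℕ i × OrderedFrom k (map (unmove-letter i c) (as ++ (c , F.zero) ∷ bs))
  orderedFrom-unmove-split k c as bs sk≤n nzA nzB ordered = i , k≤i , (begin
      map forget (filter (label≥? k) (map ρ (as ++ x ∷ bs)))
    ≡⟨ cong (map forget) (filter-unmove-around-0 i c k k≤i as bs nzA nzB) ⟩
      map forget (map ρ Fa ++ ρ x ∷ map ρ Fb)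
    ≡⟨ LP.map-++ forget (map ρ Fa) _ ⟩
      map forget (map ρ Fa) ++ forget (ρ x) ∷ map forget (map ρ Fb)
    ≡⟨ cong₂ _++_ (unmove-run-≤ i c Fa (suc k) R (s≤s z≤n) (ℕP.≤-reflexive (cong suc (sym toℕ-i))) Fa-run)
                  (cong₂ _∷_ (cong₂ _,_ (⊖-self c) toℕ-i)
                             (unmove-run-> i c Fb (suc k + R) S (ℕP.≤-reflexive (cong suc toℕ-i)) Fb-run)) ⟩
      run k R ++ (c0 p , k + R) ∷ run (suc (k + R)) S
    ≡⟨ run-++ k R S ⟩
      run k (R + suc S)
    ≡⟨ cong (run k) R+1+S≡n∸k ⟩
      run k (n ∸ k)
    ∎)
    where
    open ≡-Reasoning
    x  = (c , F.zero)
    Fa = filter (label≥? (suc k)) as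
    Fb = filter (label≥? (suc k)) bs
    R = length (map forget Fa)
    S = (n ∸ suc k) ∸ R
    pieces = run-++⁻ (map forget Fa) (map forget Fb) (suc k) (n ∸ suc k) (orderedFrom-suc-around-0 k c as bs ordered)
    Fa-run = proj₁ pieces
    Fb-run = proj₁ (proj₂ pieces)
    R≤ = proj₂ (proj₂ pieces)
    k+R<n : k + R < n
    k+R<n = ℕP.≤-trans (ℕP.+-monoʳ-≤ (suc k) R≤) (ℕP.≤-reflexive (ℕP.m+[n∸m]≡n sk≤n))
    i : Fin n
    i = F.fromℕ< k+R<n
    ρ = unmove-letter i c
    toℕ-i : toℕ i ≡ k + R
    toℕ-i = FinP.toℕ-fromℕ< k+R<n
    k≤i : k ≤ toℕ i
    k≤i = subst (k ≤_) (sym toℕ-i) (ℕP.m≤m+n k R)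
    R+1+S≡n∸k : R + suc S ≡ n ∸ k
    R+1+S≡n∸k = trans (ℕP.+-suc R S) (trans (cong suc (ℕP.m+[n∸m]≡n R≤)) (sym (ℕP.+-∸-assoc 1 (ℕP.≤-pred sk≤n))))

  orderedFrom-unmove-≥ : ∀ k → suc k ≤ n → ∀ w → IsColoredPerm w → OrderedFrom (suc k) (toList w) →
                         ∃ λ i → ∃ λ j → k ≤ toℕ i × OrderedFrom k (toList (unmove i j w))
  orderedFrom-unmove-≥ k sk≤n w perm ordered with ∃-label-0 w perm
  ... | c , c∈w with ∈-∃++ c∈w
  ... | as , bs , w≡ with orderedFrom-unmove-split k c as bs sk≤n nzA nzB (subst (OrderedFrom (suc k)) w≡ ordered)
    where
    labels≡ : map proj₂ (toList w) ≡ map proj₂ as ++ F.zero ∷ map proj₂ bs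
    labels≡ = trans (cong (map proj₂) w≡) (LP.map-++ proj₂ as ((c , F.zero) ∷ bs))
    0∉ = ∉-middle (map proj₂ as) (subst Unique labels≡ perm)
    nzA : ∀ y → y ∈ as → proj₂ y ≢ F.zero
    nzA y y∈as e = proj₁ 0∉ (subst (_∈ map proj₂ as) e (∈-map⁺ proj₂ y∈as))
    nzB : ∀ y → y ∈ bs → proj₂ y ≢ F.zero
    nzB y y∈bs e = proj₂ 0∉ (subst (_∈ map proj₂ bs) e (∈-map⁺ proj₂ y∈bs))
  ... | i , k≤i , ordered′ =
    i , c , k≤i , subst (OrderedFrom k) (sym (trans (VecP.toList-map (unmove-letter i c) w)
                                                     (cong (map (unmove-letter i c)) w≡)))
                                         ordered′

module Uniform (p n : ℕ) .{{_ : NonZero p}} where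

  open import Data.Nat using (_*_; _^_; _!)
  open import Data.List using (length)
  import Data.Nat.Properties as ℕP
  open import Data.Integer using (+_)
  open import Data.Rational as ℚ using (ℚ; 0ℚ; 1ℚ; _/_; _≤_)
  import Data.Rational.Properties as ℚP
  open import Data.List.Membership.Propositional using (_∈_)
  open import Relation.Nullary using (yes; no)
  open import Relation.Binary.PropositionalEquality
  open import Data.Empty using (⊥-elim)
  open import Defs
  open Fractions
  open Sums
  open Enumeration
  open GroupOrder using (length-G)

  instance
    |G|≢0 : NonZero (p ^ n * n !)
    |G|≢0 = ℕP.m*n≢0 (p ^ n) (n !) {{ℕP.m^n≢0 p n}} {{ℕP._!≢0 n}}

  1/|G| : ℚ
  1/|G| = + 1 / (p ^ n * n !)

  uniform-∈G : ∀ w → w ∈ G p n → uniform p n w ≡ 1/|G|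
  uniform-∈G w w∈G with isColoredPerm? w
  ... | yes _     = refl
  ... | no ¬perm = ⊥-elim (¬perm (∈-G⁻ p n w∈G))

  0≤uniform : ∀ w → w ∈ G p n → 0ℚ ≤ uniform p n w
  0≤uniform w w∈G = subst (0ℚ ≤_) (sym (uniform-∈G w w∈G)) (0≤/ 1 (p ^ n * n !))

  Σ-uniform : Σℚ (G p n) (uniform p n) ≡ 1ℚ
  Σ-uniform = begin
    Σℚ (G p n) (uniform p n)                ≡⟨ Σ-cong (G p n) uniform-∈G ⟩
    Σℚ (G p n) (λ _ → 1/|G|)                ≡⟨ Σ-const (G p n) 1/|G| ⟩
    fromℕ (length (G p n)) ℚ.* 1/|G|        ≡⟨ cong (λ t → fromℕ t ℚ.* 1/|G|) (length-G p n) ⟩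
    fromℕ (p ^ n * n !) ℚ.* 1/|G|           ≡⟨ ℚP.*-comm (fromℕ (p ^ n * n !)) 1/|G| ⟩
    1/|G| ℚ.* fromℕ (p ^ n * n !)           ≡⟨ 1/n*n≡1 (p ^ n * n !) ⟩
    1ℚ                                      ∎
    where open ≡-Reasoning

module LowerBound (p m : ℕ) .{{_ : NonZero p}} where

  open import Data.Nat as ℕ using (zero; suc; _+_; _*_; _^_; _!; _<?_)
  import Data.Nat.Properties as ℕP
  open import Data.Nat.Solver using (module +-*-Solver)
  open import Data.Integer using (+_)
  open import Data.Fin using (Fin; toℕ)
  open import Data.Product using (_×_; _,_; ∃)
  open import Data.List using (allFin; upTo)
  import Data.List.Properties as LP
  open import Data.List.Membership.Propositional using (_∈_)
  open import Data.List.Membership.Propositional.Properties using (∈-allFin)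
  open import Data.Vec using (toList)
  open import Data.Rational as ℚ using (ℚ; 0ℚ; 1ℚ; _/_; _≤_)
  import Data.Rational.Properties as ℚP
  open import Relation.Nullary using (yes; no; does)
  open import Relation.Binary.PropositionalEquality
  open import Defs
  open Fractions
  open Sums
  open Counting
  open Enumeration
  open Moves
  open TopToRandom p m
  open OrderedTail p m
  open GroupAlgebra p n
  open Colours p

  P : ℕ → ℚG p n
  P k = T ^⋆ k

  0≤P : ∀ k → NonNeg (P k)
  0≤P zero    w = 0≤δ (e p n) w
  0≤P (suc k)   = 0≤⋆ T (P k) 0≤T (0≤P k)

  ΣP≤1 : ∀ k → Σℚ (G p n) (P k) ≤ 1ℚ
  ΣP≤1 zero    = Σδ≤1 (e p n) (G p n) (Unique-G p n)
  ΣP≤1 (suc k) = mass-⋆≤1 T (P k) 0≤T (0≤P k) ΣT≤1 (ΣP≤1 k)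

  private
    p^a*n^k≢0 : ∀ a k → ℕ.NonZero (p ^ a * n ^ k)
    p^a*n^k≢0 a k = ℕP.m*n≢0 (p ^ a) (n ^ k) {{ℕP.m^n≢0 p a}} {{ℕP.m^n≢0 n k}}

  β : ℕ → ℕ → ℚ
  β k a = _/_ (+ S₂ k a) (p ^ a * n ^ k) {{p^a*n^k≢0 a k}}

  0≤β : ∀ k a → 0ℚ ≤ β k a
  0≤β k a = 0≤/ (S₂ k a) (p ^ a * n ^ k) {{p^a*n^k≢0 a k}}

  β-0-suc : ∀ a → β 0 (suc a) ≡ 0ℚ
  β-0-suc a = /-cong-cross 0 (p ^ suc a * 1) 0 1 {{p^a*n^k≢0 (suc a) 0}} refl

  β-suc-0 : ∀ k → β (suc k) 0 ≡ 0ℚ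
  β-suc-0 k = /-cong-cross 0 (1 * n ^ suc k) 0 1 {{p^a*n^k≢0 0 (suc k)}} refl

  β-suc-suc : ∀ k a → β (suc k) (suc a) ≡ weight ℚ.* (fromℕ (suc a * p) ℚ.* β k (suc a) ℚ.+ β k a)
  β-suc-suc k a = sym (begin
      weight ℚ.* (fromℕ x ℚ.* β k (suc a) ℚ.+ β k a)
    ≡⟨ cong (λ s → weight ℚ.* (s ℚ.+ β k a)) (/-*-/ x 1 S1 D1 {{_}} {{nz1}}) ⟩
      weight ℚ.* (_/_ (+ (x * S1)) (1 * D1) {{nz1′}} ℚ.+ β k a)
    ≡⟨ cong (weight ℚ.*_) (/-+-/ (x * S1) (1 * D1) S0 D0 {{nz1′}} {{nz0}}) ⟩
      weight ℚ.* _/_ (+ num) (1 * D1 * D0) {{nz10}}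
    ≡⟨ /-*-/ 1 (p * n) num (1 * D1 * D0) {{ℕP.m*n≢0 p n}} {{nz10}} ⟩
      _/_ (+ (1 * num)) (p * n * (1 * D1 * D0)) {{nz}}
    ≡⟨ /-cong-cross (1 * num) (p * n * (1 * D1 * D0)) (S₂ (suc k) (suc a)) (p ^ suc a * n ^ suc k)
                    {{nz}} {{p^a*n^k≢0 (suc a) (suc k)}} cross ⟩
      β (suc k) (suc a)
    ∎)
    where
    open ≡-Reasoning
    x = suc a * p
    S1 = S₂ k (suc a)
    S0 = S₂ k a
    D1 = p ^ suc a * n ^ k
    D0 = p ^ a * n ^ k
    nz1 = p^a*n^k≢0 (suc a) k
    nz0 = p^a*n^k≢0 a k
    nz1′ : ℕ.NonZero (1 * D1)
    nz1′ = ℕP.m*n≢0 1 D1 {{_}} {{nz1}}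
    nz10 : ℕ.NonZero (1 * D1 * D0)
    nz10 = ℕP.m*n≢0 (1 * D1) D0 {{nz1′}} {{nz0}}
    nz : ℕ.NonZero (p * n * (1 * D1 * D0))
    nz = ℕP.m*n≢0 (p * n) (1 * D1 * D0) {{ℕP.m*n≢0 p n}} {{nz10}}
    num = x * S1 * D0 + S0 * (1 * D1)
    cross : 1 * num * (p ^ suc a * n ^ suc k) ≡ S₂ (suc k) (suc a) * (p * n * (1 * D1 * D0))
    cross = solve 7 (λ A p P N nn s1 s0 →
        con 1 :* ((A :* p) :* s1 :* (P :* N) :+ s0 :* (con 1 :* ((p :* P) :* N))) :* ((p :* P) :* (nn :* N))
        := (A :* s1 :+ s0) :* ((p :* nn) :* ((con 1 :* ((p :* P) :* N)) :* (P :* N)))) refl (suc a) p (p ^ a) (n ^ k) n S1 S0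
      where open +-*-Solver

  contribution : ℕ → Word p n → ℕ → ℚ
  contribution k w a = when (orderedFrom? a (toList w)) (β k a)

  0≤contribution : ∀ k w a → 0ℚ ≤ contribution k w a
  0≤contribution k w a = 0≤when (orderedFrom? a (toList w)) (0≤β k a)

  Bound : ℕ → Set
  Bound k = ∀ w → w ∈ G p n → Σℚ (upTo (suc n)) (contribution k w) ≤ P k w

  bound-0 : Bound 0
  bound-0 w _ = subst (_≤ P 0 w) (sym Σ≡level-0) level-0
    where
    Σ≡level-0 : Σℚ (upTo (suc n)) (contribution 0 w) ≡ contribution 0 w 0
    Σ≡level-0 = trans (Σ-upTo-suc n (contribution 0 w))
      (trans (cong (contribution 0 w 0 ℚ.+_)
                   (trans (Σ-cong (upTo n) (λ a _ → when-≡0 (orderedFrom? (suc a) (toList w)) (λ _ → β-0-suc a)))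
                          (Σ-0 (upTo n))))
             (ℚP.+-identityʳ _))
    level-0 : contribution 0 w 0 ≤ P 0 w
    level-0 with orderedFrom? 0 (toList w)
    ... | yes ordered = subst (λ u → 1ℚ ≤ δ (e p n) u) (sym (orderedFrom-0⇒e w ordered))
                              (ℚP.≤-reflexive (sym (δ-refl (e p n))))
    ... | no _        = 0≤δ (e p n) w

  -- stay a collects the a·p moves with i < a, which keep w in O_a; rise a the move with i ≥ a leading from O_a to
  -- O_{a+1}. S< and S≥ split all moves in the same way.
  module Step (k : ℕ) (ih : Bound k) (w : Word p n) (w∈G : w ∈ G p n) where
    X : Fin n → Fin p → ℕ → ℚ
    X i j a = contribution k (unmove i j w) a

    S< S≥ : ℕ → ℚ
    S< a = Σℚ (allFin n) (λ i → Σℚ (allFin p) (λ j → when (toℕ i <? a) (X i j a)))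
    S≥ a = Σℚ (allFin n) (λ i → Σℚ (allFin p) (λ j → unless (toℕ i <? a) (X i j a)))

    stay rise : ℕ → ℚ
    stay a = when (orderedFrom? a (toList w)) (fromℕ (a * p) ℚ.* β k a)
    rise a = when (orderedFrom? (suc a) (toList w)) (β k a)

    0≤X : ∀ i j a → 0ℚ ≤ X i j a
    0≤X i j a = 0≤contribution k (unmove i j w) a

    0≤S< : ∀ a → 0ℚ ≤ S< a
    0≤S< a = 0≤Σ (allFin n) (λ i _ → 0≤Σ (allFin p) (λ j _ → 0≤when (toℕ i <? a) (0≤X i j a)))

    0≤S≥ : ∀ a → 0ℚ ≤ S≥ a
    0≤S≥ a = 0≤Σ (allFin n) (λ i _ → 0≤Σ (allFin p) (λ j _ → 0≤unless (toℕ i <? a) (0≤X i j a)))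

    stay≤S< : ∀ a → a ∈ upTo (suc n) → stay a ≤ S< a
    stay≤S< a a∈ with orderedFrom? a (toList w)
    ... | no _        = 0≤S< a
    ... | yes ordered = ℚP.≤-reflexive (sym (begin
      S< a
        ≡⟨ Σ-cong (allFin n) (λ i _ → trans (Σ-when (allFin p) (toℕ i <? a) (λ j → X i j a))
                                             (when-cong (toℕ i <? a) (λ i<a → all-moves i i<a))) ⟩
      Σℚ (allFin n) (λ i → when (toℕ i <? a) (fromℕ p ℚ.* β k a))
        ≡⟨ Σ-if (allFin n) (λ i → does (toℕ i <? a)) (fromℕ p ℚ.* β k a) ⟩
      fromℕ (count (λ i → does (toℕ i <? a)) (allFin n)) ℚ.* (fromℕ p ℚ.* β k a)
        ≡⟨ cong (λ t → fromℕ t ℚ.* (fromℕ p ℚ.* β k a)) (count-<-allFin n a (ℕP.≤-pred (∈-upTo⁻ a∈))) ⟩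
      fromℕ a ℚ.* (fromℕ p ℚ.* β k a)
        ≡⟨ sym (ℚP.*-assoc (fromℕ a) (fromℕ p) (β k a)) ⟩
      fromℕ a ℚ.* fromℕ p ℚ.* β k a
        ≡⟨ cong (ℚ._* β k a) (sym (fromℕ-* a p)) ⟩
      fromℕ (a * p) ℚ.* β k a
        ∎))
      where
      open ≡-Reasoning
      all-moves : ∀ i → toℕ i ℕ.< a → Σℚ (allFin p) (λ j → X i j a) ≡ fromℕ p ℚ.* β k a
      all-moves i i<a = trans (Σ-cong (allFin p) (λ j _ → when-yes (orderedFrom? a (toList (unmove i j w)))
                                                             (orderedFrom-unmove-< i j a i<a w ordered)))
                              (trans (Σ-const (allFin p) (β k a))
                                     (cong (λ t → fromℕ t ℚ.* β k a) (LP.length-tabulate {n = p} (λ x → x))))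

    rise≤S≥ : ∀ a → a ∈ upTo n → rise a ≤ S≥ a
    rise≤S≥ a a∈ = when-≤ (orderedFrom? (suc a) (toList w)) (0≤S≥ a)
      (λ ordered → via-one-move (orderedFrom-unmove-≥ a (∈-upTo⁻ a∈) w (∈-G⁻ p n w∈G) ordered))
      where
      open ℚP.≤-Reasoning
      via-one-move : (∃ λ i → ∃ λ j → a ℕ.≤ toℕ i × OrderedFrom a (toList (unmove i j w))) → β k a ≤ S≥ a
      via-one-move (i , j , a≤i , ordered′) = begin
        β k a
          ≡⟨ sym (trans (unless-no (toℕ i <? a) (ℕP.≤⇒≯ a≤i))
                        (when-yes (orderedFrom? a (toList (unmove i j w))) ordered′)) ⟩
        unless (toℕ i <? a) (X i j a)
          ≤⟨ ∈⇒≤Σ (allFin p) {λ j′ → unless (toℕ i <? a) (X i j′ a)} j (∈-allFin j)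
                  (λ j′ _ → 0≤unless (toℕ i <? a) (0≤X i j′ a)) ⟩
        Σℚ (allFin p) (λ j′ → unless (toℕ i <? a) (X i j′ a))
          ≤⟨ ∈⇒≤Σ (allFin n) {λ i′ → Σℚ (allFin p) (λ j′ → unless (toℕ i′ <? a) (X i′ j′ a))} i (∈-allFin i)
                  (λ i′ _ → 0≤Σ (allFin p) (λ j′ _ → 0≤unless (toℕ i′ <? a) (0≤X i′ j′ a))) ⟩
        S≥ a
          ∎

    contribution-suc : ∀ a → contribution (suc k) w (suc a) ≡ weight ℚ.* (stay (suc a) ℚ.+ rise a)
    contribution-suc a with orderedFrom? (suc a) (toList w)
    ... | yes _ = β-suc-suc k a
    ... | no _  = sym (trans (cong (weight ℚ.*_) (ℚP.+-identityˡ 0ℚ)) (ℚP.*-zeroʳ weight))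

    Σ-contribution-suc : Σℚ (upTo (suc n)) (contribution (suc k) w)
                       ≡ weight ℚ.* (Σℚ (upTo (suc n)) stay ℚ.+ Σℚ (upTo n) rise)
    Σ-contribution-suc = begin
      Σℚ (upTo (suc n)) (contribution (suc k) w)
        ≡⟨ Σ-upTo-suc n (contribution (suc k) w) ⟩
      contribution (suc k) w 0 ℚ.+ Σℚ (upTo n) (λ a → contribution (suc k) w (suc a))
        ≡⟨ cong₂ ℚ._+_ level-0 (Σ-cong (upTo n) (λ a _ → contribution-suc a)) ⟩
      0ℚ ℚ.+ Σℚ (upTo n) (λ a → weight ℚ.* (stay (suc a) ℚ.+ rise a))
        ≡⟨ ℚP.+-identityˡ _ ⟩
      Σℚ (upTo n) (λ a → weight ℚ.* (stay (suc a) ℚ.+ rise a))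
        ≡⟨ Σ-*ˡ (upTo n) weight _ ⟩
      weight ℚ.* Σℚ (upTo n) (λ a → stay (suc a) ℚ.+ rise a)
        ≡⟨ cong (weight ℚ.*_) (Σ-+ (upTo n) (λ a → stay (suc a)) rise) ⟩
      weight ℚ.* (Σℚ (upTo n) (λ a → stay (suc a)) ℚ.+ Σℚ (upTo n) rise)
        ≡⟨ cong (λ s → weight ℚ.* (s ℚ.+ Σℚ (upTo n) rise)) (sym Σ-stay) ⟩
      weight ℚ.* (Σℚ (upTo (suc n)) stay ℚ.+ Σℚ (upTo n) rise)
        ∎
      where
      open ≡-Reasoning
      level-0 : contribution (suc k) w 0 ≡ 0ℚ
      level-0 = when-≡0 (orderedFrom? 0 (toList w)) (λ _ → β-suc-0 k)
      Σ-stay : Σℚ (upTo (suc n)) stay ≡ Σℚ (upTo n) (λ a → stay (suc a))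
      Σ-stay = trans (Σ-upTo-suc n stay)
        (trans (cong (ℚ._+ Σℚ (upTo n) (λ a → stay (suc a)))
                     (when-≡0 (orderedFrom? 0 (toList w)) (λ _ → ℚP.*-zeroˡ (β k 0))))
               (ℚP.+-identityˡ _))

    Σ-S<+S≥ : Σℚ (upTo (suc n)) S< ℚ.+ Σℚ (upTo (suc n)) S≥
            ≡ Σℚ (allFin n) (λ i → Σℚ (allFin p) (λ j → Σℚ (upTo (suc n)) (X i j)))
    Σ-S<+S≥ = begin
      Σℚ (upTo (suc n)) S< ℚ.+ Σℚ (upTo (suc n)) S≥
        ≡⟨ sym (Σ-+ (upTo (suc n)) S< S≥) ⟩
      Σℚ (upTo (suc n)) (λ a → S< a ℚ.+ S≥ a)
        ≡⟨ Σ-cong (upTo (suc n)) (λ a _ →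
             trans (sym (Σ-+ (allFin n) (λ i → Σℚ (allFin p) (λ j → when (toℕ i <? a) (X i j a)))
                                        (λ i → Σℚ (allFin p) (λ j → unless (toℕ i <? a) (X i j a)))))
             (Σ-cong (allFin n) (λ i _ →
             trans (sym (Σ-+ (allFin p) (λ j → when (toℕ i <? a) (X i j a)) (λ j → unless (toℕ i <? a) (X i j a))))
                   (Σ-cong (allFin p) (λ j _ → when+unless (toℕ i <? a) (X i j a)))))) ⟩
      Σℚ (upTo (suc n)) (λ a → Σℚ (allFin n) (λ i → Σℚ (allFin p) (λ j → X i j a)))
        ≡⟨ sym (Σ-swap (allFin n) (upTo (suc n)) (λ i a → Σℚ (allFin p) (λ j → X i j a))) ⟩
      Σℚ (allFin n) (λ i → Σℚ (upTo (suc n)) (λ a → Σℚ (allFin p) (λ j → X i j a)))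
        ≡⟨ Σ-cong (allFin n) (λ i _ → sym (Σ-swap (allFin p) (upTo (suc n)) (λ j a → X i j a))) ⟩
      Σℚ (allFin n) (λ i → Σℚ (allFin p) (λ j → Σℚ (upTo (suc n)) (X i j)))
        ∎
      where open ≡-Reasoning

    bound-suc : Σℚ (upTo (suc n)) (contribution (suc k) w) ≤ P (suc k) w
    bound-suc = begin
      Σℚ (upTo (suc n)) (contribution (suc k) w)
        ≡⟨ Σ-contribution-suc ⟩
      weight ℚ.* (Σℚ (upTo (suc n)) stay ℚ.+ Σℚ (upTo n) rise)
        ≤⟨ *-monoʳ-≤-0≤ weight 0≤weight (ℚP.+-mono-≤ (Σ-mono-≤ (upTo (suc n)) stay≤S<) Σ-rise≤) ⟩
      weight ℚ.* (Σℚ (upTo (suc n)) S< ℚ.+ Σℚ (upTo (suc n)) S≥)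
        ≡⟨ cong (weight ℚ.*_) Σ-S<+S≥ ⟩
      weight ℚ.* Σℚ (allFin n) (λ i → Σℚ (allFin p) (λ j → Σℚ (upTo (suc n)) (X i j)))
        ≡⟨ sym (trans (Σ-cong (allFin n) (λ i _ → Σ-*ˡ (allFin p) weight _)) (Σ-*ˡ (allFin n) weight _)) ⟩
      Σℚ (allFin n) (λ i → Σℚ (allFin p) (λ j → weight ℚ.* Σℚ (upTo (suc n)) (X i j)))
        ≤⟨ Σ-mono-≤ (allFin n) (λ i _ → Σ-mono-≤ (allFin p) (λ j _ →
             *-monoʳ-≤-0≤ weight 0≤weight (ih (unmove i j w) (∈-G⁺ p n _ (unmove-perm i j w (∈-G⁻ p n w∈G)))))) ⟩
      Σℚ (allFin n) (λ i → Σℚ (allFin p) (λ j → weight ℚ.* P k (unmove i j w)))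
        ≤⟨ Σ-unmove≤T⋆ (P k) (0≤P k) w w∈G ⟩
      P (suc k) w
        ∎
      where
      open ℚP.≤-Reasoning
      Σ-rise≤ : Σℚ (upTo n) rise ≤ Σℚ (upTo (suc n)) S≥
      Σ-rise≤ = ℚP.≤-trans (Σ-mono-≤ (upTo n) rise≤S≥)
        (subst (Σℚ (upTo n) S≥ ≤_) (sym (Σ-upTo-∷ʳ n S≥))
               (subst (_≤ Σℚ (upTo n) S≥ ℚ.+ S≥ n) (ℚP.+-identityʳ _) (ℚP.+-monoʳ-≤ (Σℚ (upTo n) S≥) (0≤S≥ n))))

  bound : ∀ k → Bound k
  bound zero    = bound-0
  bound (suc k) w w∈G = Step.bound-suc k (bound k) w w∈G

  β≤P : ∀ k w → w ∈ G p n → β k n ≤ P k w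
  β≤P k w w∈G = begin
    β k n
      ≡⟨ sym (when-yes (orderedFrom? n (toList w)) (orderedFrom-n (toList w))) ⟩
    contribution k w n
      ≤⟨ ∈⇒≤Σ (upTo (suc n)) n (∈-upTo⁺ (ℕP.n<1+n n)) (λ a _ → 0≤contribution k w a) ⟩
    Σℚ (upTo (suc n)) (contribution k w)
      ≤⟨ bound k w w∈G ⟩
    P k w
      ∎
    where open ℚP.≤-Reasoning

  scaled-uniform≤P : ∀ k w → w ∈ G p n →
                     _/_ (+ (S₂ k n * n !)) (n ^ k) {{ℕP.m^n≢0 n k}} ℚ.* uniform p n w ≤ P k w
  scaled-uniform≤P k w w∈G = subst (_≤ P k w) (sym (trans (cong (a ℚ.*_) (uniform-∈G w w∈G)) a/|G|≡β)) (β≤P k w w∈G)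
    where
    open Uniform p n
    a = _/_ (+ (S₂ k n * n !)) (n ^ k) {{ℕP.m^n≢0 n k}}
    a/|G|≡β : a ℚ.* 1/|G| ≡ β k n
    a/|G|≡β = trans (/-*-/ (S₂ k n * n !) (n ^ k) 1 (p ^ n * n !) {{ℕP.m^n≢0 n k}})
      (/-cong-cross (S₂ k n * n ! * 1) (n ^ k * (p ^ n * n !)) (S₂ k n) (p ^ n * n ^ k)
                    {{ℕP.m*n≢0 (n ^ k) (p ^ n * n !) {{ℕP.m^n≢0 n k}}}} {{p^a*n^k≢0 n k}}
        (solve 4 (λ S f P N → (S :* f :* con 1) :* (P :* N) := S :* (N :* (P :* f))) refl (S₂ k n) (n !) (p ^ n) (n ^ k)))
      where open +-*-Solver

module TotalVariation where

  open import Data.Integer using (+_)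
  open import Data.Rational using (ℚ; 0ℚ; 1ℚ; _/_; _+_; _*_; _-_; -_; ∣_∣; _≤_)
  import Data.Rational.Properties as ℚP
  open import Data.Rational.Solver using (module +-*-Solver)
  open import Data.Sum using (inj₁; inj₂)
  open import Data.List using (List)
  open import Data.List.Membership.Propositional using (_∈_)
  open import Relation.Binary.PropositionalEquality
  open import Defs using (Σℚ)
  open Fractions
  open Sums

  private
    ≤-by-difference : ∀ x y d → x + d ≡ y → 0ℚ ≤ d → x ≤ y
    ≤-by-difference x y d eq 0≤d = subst₂ _≤_ (ℚP.+-identityʳ x) eq (ℚP.+-monoʳ-≤ x 0≤d)

    0≤difference : ∀ {x y} → x ≤ y → 0ℚ ≤ y - x
    0≤difference {x} {y} le = subst (_≤ y - x) (ℚP.+-inverseʳ x) (ℚP.+-monoˡ-≤ (- x) le)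

    0≤double : ∀ {x} → 0ℚ ≤ x → 0ℚ ≤ x + x
    0≤double {x} 0≤x = subst (_≤ x + x) (ℚP.+-identityʳ 0ℚ) (ℚP.+-mono-≤ 0≤x 0≤x)

    ∣∣-≤ : ∀ x y → x ≤ y → - x ≤ y → ∣ x ∣ ≤ y
    ∣∣-≤ x y x≤y -x≤y with ℚP.∣p∣≡p∨∣p∣≡-p x
    ... | inj₁ e = subst (_≤ y) (sym e) x≤y
    ... | inj₂ e = subst (_≤ y) (sym e) -x≤y

  -- If P ≥ a·U pointwise then |P − U| ≤ P + (1 − 2a)·U pointwise; summing gives ½|P − U| ≤ ½(ΣP + 1 − 2a).
  dTV-≤-1-minorant : ∀ {A : Set} (xs : List A) (P U : A → ℚ) (a : ℚ) →
    (∀ w → w ∈ xs → a * U w ≤ P w) → Σℚ xs P ≤ 1ℚ → Σℚ xs U ≡ 1ℚ → (∀ w → w ∈ xs → 0ℚ ≤ U w) →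
    (+ 1 / 2) * Σℚ xs (λ w → ∣ P w - U w ∣) ≤ 1ℚ - a
  dTV-≤-1-minorant xs P U a aU≤P ΣP≤1 ΣU≡1 0≤U = begin
    (+ 1 / 2) * Σℚ xs (λ w → ∣ P w - U w ∣)  ≤⟨ *-monoʳ-≤-0≤ (+ 1 / 2) (0≤/ 1 2) (Σ-mono-≤ xs pointwise) ⟩
    (+ 1 / 2) * Σℚ xs (λ w → P w + d * U w)  ≡⟨ cong ((+ 1 / 2) *_) Σ-pointwise ⟩
    (+ 1 / 2) * (Σℚ xs P + d)                ≤⟨ *-monoʳ-≤-0≤ (+ 1 / 2) (0≤/ 1 2) (ℚP.+-monoˡ-≤ d ΣP≤1) ⟩
    (+ 1 / 2) * (1ℚ + d)                     ≡⟨ half-of-1+d ⟩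
    1ℚ - a                                   ∎
    where
    open ℚP.≤-Reasoning
    open +-*-Solver
    b = 1ℚ - a
    d = b + b - 1ℚ
    a≤1 : a ≤ 1ℚ
    a≤1 = begin
      a                 ≡⟨ sym (trans (cong (a *_) ΣU≡1) (ℚP.*-identityʳ a)) ⟩
      a * Σℚ xs U       ≡⟨ sym (Σ-*ˡ xs a U) ⟩
      Σℚ xs (λ w → a * U w) ≤⟨ Σ-mono-≤ xs aU≤P ⟩
      Σℚ xs P           ≤⟨ ΣP≤1 ⟩
      1ℚ                ∎
    pointwise : ∀ w → w ∈ xs → ∣ P w - U w ∣ ≤ P w + d * U w
    pointwise w w∈ = ∣∣-≤ _ _
      (≤-by-difference (P w - U w) (P w + d * U w) ((b + b) * U w)
        (solve 3 (λ P U a → (P :- U) :+ (((con 1ℚ :- a) :+ (con 1ℚ :- a)) :* U)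
                         := P :+ (((con 1ℚ :- a) :+ (con 1ℚ :- a) :- con 1ℚ) :* U)) refl (P w) (U w) a)
        (0≤-* (0≤double (0≤difference a≤1)) (0≤U w w∈)))
      (≤-by-difference (- (P w - U w)) (P w + d * U w) ((P w - a * U w) + (P w - a * U w))
        (solve 3 (λ P U a → (:- (P :- U)) :+ ((P :- a :* U) :+ (P :- a :* U))
                         := P :+ (((con 1ℚ :- a) :+ (con 1ℚ :- a) :- con 1ℚ) :* U)) refl (P w) (U w) a)
        (0≤double (0≤difference (aU≤P w w∈))))
    Σ-pointwise : Σℚ xs (λ w → P w + d * U w) ≡ Σℚ xs P + d
    Σ-pointwise = trans (Σ-+ xs P (λ w → d * U w))
      (cong (λ t → Σℚ xs P + t) (trans (Σ-*ˡ xs d U) (trans (cong (d *_) ΣU≡1) (ℚP.*-identityʳ d))))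
    half-of-1+d : (+ 1 / 2) * (1ℚ + d) ≡ 1ℚ - a
    half-of-1+d = trans (solve 2 (λ h a → h :* (con 1ℚ :+ (((con 1ℚ :- a) :+ (con 1ℚ :- a)) :- con 1ℚ))
                                       := (h :+ h) :* (con 1ℚ :- a)) refl (+ 1 / 2) a)
                        (ℚP.*-identityˡ (1ℚ - a))

open import Defs
open import Data.Nat using (ℕ; zero; suc; NonZero; _<_; _*_; _^_; _!)
open import Data.Nat.Properties using (m^n≢0)
open import Data.Integer using (+_)
open import Data.Rational using (ℚ; 1ℚ; _/_; _-_; _≤_)

theorem6 : (p n : ℕ) .{{_ : NonZero p}} .{{_ : NonZero n}} → 1 < p → (k : ℕ) →
    dTV (topToRandom p n ^⋆ k) (uniform p n) ≤ 1ℚ - _/_ (+ (S₂ k n * n !)) (n ^ k) {{m^n≢0 n k}}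
theorem6 p zero    {{_}} {{()}} _ k
theorem6 p n@(suc m) _ k =
  TotalVariation.dTV-≤-1-minorant (G p n) (P k) (uniform p n) (_/_ (+ (S₂ k n * n !)) (n ^ k) {{m^n≢0 n k}})
    (scaled-uniform≤P k) (ΣP≤1 k) Σ-uniform 0≤uniform
  where
  open LowerBound p m
  open Uniform p n
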